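{- Under both semantics, $\mathsf{QCTL}^*$ and $\mathsf{QCTL}$ are equally expressive: for every $\mathsf{QCTL}^*$ formula $\Phi$ there is a $\mathsf{QCTL}$ formula $\Psi$ with $\Phi\equiv_s\Psi$ and $\Phi\equiv_t\Psi$ (and every $\mathsf{QCTL}$ formula is a $\mathsf{QCTL}^*$ formula).
   Context: Fix a set $AP$ of atomic propositions. A Kripke structure is $S=(Q,R,\ell)$ with $Q$ countable, $R\subseteq Q\times Q$ total, $\ell:Q\to2^{AP}$. A path from $q$ is an infinite $R$-path $\rho=q_0q_1\dots$ with $q_0=q$; $\rho^i$ is its suffix from position $i$. $\mathsf{QCTL}^*$ state formulas: $\varphi::=p\mid\neg\varphi\mid\varphi\vee\varphi\mid\mathbf{E}\psi\mid\exists p.\varphi$; path formulas: $\psi::=\varphi\mid\neg\psi\mid\psi\vee\psi\mid\mathbf{X}\psi\mid\psi\mathbf{U}\psi$; only state formulas are $\mathsf{QCTL}^*$ formulas. $\mathsf{QCTL}$ is the fragment $\varphi::=p\mid\neg\varphi\mid\varphi\vee\varphi\mid\exists p.\varphi\mid\mathbf{E}\varphi\mathbf{U}\varphi\mid\mathbf{A}\varphi\mathbf{U}\varphi\mid\mathbf{EX}\varphi\mid\mathbf{AX}\varphi$ (with $\mathbf{A}=\neg\mathbf{E}\neg$). Structure semantics $\models_s$: $S,q\models_s p$ iff $p\in\ell(q)$; Boolean cases as usual; $S,q\models_s\mathbf{E}\psi$ iff some path $\rho$ from $q$ satisfies $\psi$; $S,q\models_s\exists p.\varphi$ iff some $S'=(Q,R,\ell')$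 with $\ell'$ agreeing with $\ell$ on $AP\setminus\{p\}$ satisfies $S',q\models_s\varphi$; a path satisfies a state formula iff its first state does; $S,\rho\models_s\mathbf{X}\psi$ iff $S,\rho^1\models_s\psi$; $S,\rho\models_s\psi_1\mathbf{U}\psi_2$ iff there is $i\ge0$ with $S,\rho^i\models_s\psi_2$ and $S,\rho^j\models_s\psi_1$ for all $j<i$. Tree semantics: $S,q\models_t\varphi$ iff $T_S(q),q\models_s\varphi$, where $T_S(q)$ (for finite $S$) is the unwinding of $S$ from $q$: states are finite prefixes of paths from $q$, edges go to one-step extensions, labels are those of last states, root $q$. $\varphi\equiv_s\psi$ iff for every finite Kripke structure $S$ and state $q$, $S,q\models_s\varphi\iff S,q\models_s\psi$; $\equiv_t$ likewise with $\models_t$. -}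

module Defs where

open import Level using (0ℓ)
open import Data.Nat using (ℕ; zero; suc; _+_; _<_)
open import Data.Fin using (Fin)
open import Data.Bool using (Bool; T)
open import Data.List using (List; []; _∷_)
open import Data.Product using (Σ; ∃; _×_; _,_; proj₁)
open import Data.Sum using (_⊎_)
open import Data.Empty using (⊥)
open import Relation.Nullary using (¬_)
open import Relation.Binary.PropositionalEquality using (_≡_; _≢_; refl)
open import Function.Bundles using (_↔_)

module Syntax (AP : Set) where

  mutual
    data StateF : Set where
      atom : AP → StateF
      ¬ₛ_  : StateF → StateF
      _∨ₛ_ : StateF → StateF → StateF
      E    : PathF → StateF
      ∃ₚ   : AP → StateF → StateF

    data PathF : Set where
      st   : StateF → PathF
      ¬ₚ_  : PathF → PathF
      _∨ₚ_ : PathF → PathF → PathF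
      X    : PathF → PathF
      _U_  : PathF → PathF → PathF

  data QCTL : Set where
    atom : AP → QCTL
    ¬q_  : QCTL → QCTL
    _∨q_ : QCTL → QCTL → QCTL
    ∃q   : AP → QCTL → QCTL
    EU   : QCTL → QCTL → QCTL
    AU   : QCTL → QCTL → QCTL
    EX   : QCTL → QCTL
    AX   : QCTL → QCTL

  A : PathF → StateF
  A ψ = ¬ₛ (E (¬ₚ ψ))

  embed : QCTL → StateF
  embed (atom p)   = atom p
  embed (¬q φ)     = ¬ₛ embed φ
  embed (φ ∨q ψ)   = embed φ ∨ₛ embed ψ
  embed (∃q p φ)   = ∃ₚ p (embed φ)
  embed (EU φ ψ)   = E (st (embed φ) U st (embed ψ))
  embed (AU φ ψ)   = A (st (embed φ) U st (embed ψ))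
  embed (EX φ)     = E (X (st (embed φ)))
  embed (AX φ)     = A (X (st (embed φ)))

record Kripke (AP : Set) : Set₁ where
  field
    Q     : Set
    R     : Q → Q → Set
    total : ∀ q → Σ Q (R q)
    ℓ     : Q → AP → Bool

module _ {AP : Set} where
  open Syntax AP
  open Kripke

  relabel : (S : Kripke AP) → (Q S → AP → Bool) → Kripke AP
  relabel S ℓ' = record { Q = Q S ; R = R S ; total = total S ; ℓ = ℓ' }

  record Path (S : Kripke AP) : Set where
    field
      seq  : ℕ → Q S
      step : ∀ i → R S (seq i) (seq (suc i))
  open Path

  suffix : {S : Kripke AP} → ℕ → Path S → Path S
  suffix k ρ = record { seq = λ i → seq ρ (i + k) ; step = λ i → step ρ (i + k) }

  mutual
    _,_⊨ₛ_ : (S : Kripke AP) → Q S → StateF → Set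
    S , q ⊨ₛ atom p   = ℓ S q p ≡ Data.Bool.true
    S , q ⊨ₛ (¬ₛ φ)   = ¬ (S , q ⊨ₛ φ)
    S , q ⊨ₛ (φ ∨ₛ ψ) = (S , q ⊨ₛ φ) ⊎ (S , q ⊨ₛ ψ)
    S , q ⊨ₛ E ψ      = Σ (Path S) λ ρ → (seq ρ 0 ≡ q) × (S , ρ ⊨ₚ ψ)
    S , q ⊨ₛ ∃ₚ p φ   =
      Σ (Q S → AP → Bool) λ ℓ' →
        (∀ q' a → a ≢ p → ℓ' q' a ≡ ℓ S q' a) × (relabel S ℓ' , q ⊨ₛ φ)

    _,_⊨ₚ_ : (S : Kripke AP) → Path S → PathF → Set
    S , ρ ⊨ₚ st φ     = S , seq ρ 0 ⊨ₛ φ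
    S , ρ ⊨ₚ (¬ₚ ψ)   = ¬ (S , ρ ⊨ₚ ψ)
    S , ρ ⊨ₚ (ψ ∨ₚ χ) = (S , ρ ⊨ₚ ψ) ⊎ (S , ρ ⊨ₚ χ)
    S , ρ ⊨ₚ X ψ      = S , suffix 1 ρ ⊨ₚ ψ
    S , ρ ⊨ₚ (ψ U χ)  =
      Σ ℕ λ i → (S , suffix i ρ ⊨ₚ χ) × (∀ j → j < i → S , suffix j ρ ⊨ₚ ψ)

record FinKripke (AP : Set) (n : ℕ) : Set where
  field
    R     : Fin n → Fin n → Bool
    total : ∀ q → Σ (Fin n) λ q' → T (R q q')
    ℓ     : Fin n → AP → Bool

module _ {AP : Set} {n : ℕ} where

  toKripke : FinKripke AP n → Kripke AP
  toKripke S = record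
    { Q = Fin n ; R = λ a b → T (FinKripke.R S a b)
    ; total = FinKripke.total S ; ℓ = FinKripke.ℓ S }

  -- finite path prefixes from q, stored in reverse (last state first)
  ValidPrefix : FinKripke AP n → Fin n → List (Fin n) → Set
  ValidPrefix S q []           = ⊥
  ValidPrefix S q (x ∷ [])     = x ≡ q
  ValidPrefix S q (x ∷ y ∷ xs) = T (FinKripke.R S y x) × ValidPrefix S q (y ∷ xs)

  Prefix : FinKripke AP n → Fin n → Set
  Prefix S q = Σ (List (Fin n)) (ValidPrefix S q)

  lastState : {S : FinKripke AP n} {q : Fin n} → Prefix S q → Fin n
  lastState (x ∷ _ , _) = x

  extend : (S : FinKripke AP n) (q : Fin n) (u : Prefix S q) →
           Σ (Prefix S q) λ v → ∃ λ x → proj₁ v ≡ x ∷ proj₁ u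
  extend S q (x ∷ xs , v) with FinKripke.total S x
  ... | y , r = ((y ∷ x ∷ xs) , (r , v)) , y , refl

  unwind : FinKripke AP n → Fin n → Kripke AP
  unwind S q = record
    { Q     = Prefix S q
    ; R     = λ u v → ∃ λ x → proj₁ v ≡ x ∷ proj₁ u
    ; total = extend S q
    ; ℓ     = λ u → FinKripke.ℓ S (lastState u)
    }

  root : (S : FinKripke AP n) (q : Fin n) → Prefix S q
  root S q = (q ∷ []) , refl

module _ {AP : Set} where
  open Syntax AP

  _,_⊨s_ : ∀ {n} → FinKripke AP n → Fin n → StateF → Set
  S , q ⊨s φ = toKripke S , q ⊨ₛ φ

  _,_⊨t_ : ∀ {n} → FinKripke AP n → Fin n → StateF → Set
  S , q ⊨t φ = unwind S q , root S q ⊨ₛ φ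

  _⇔_ : Set → Set → Set
  A ⇔ B = (A → B) × (B → A)

  _≡s_ : StateF → StateF → Set
  φ ≡s ψ = ∀ n (S : FinKripke AP n) (q : Fin n) → (S , q ⊨s φ) ⇔ (S , q ⊨s ψ)

  _≡t_ : StateF → StateF → Set
  φ ≡t ψ = ∀ n (S : FinKripke AP n) (q : Fin n) → (S , q ⊨t φ) ⇔ (S , q ⊨t ψ)

module Submission where

open import Defs
open import Level using (0ℓ)
open import Axiom.ExcludedMiddle using (ExcludedMiddle)
open import Data.Unit using (⊤)
open import Data.Empty using (⊥-elim)
open import Data.Bool using (Bool; true; false; _∧_; _∨_; not)
open import Data.Nat using (ℕ; zero; suc; _+_; _*_; _∸_; _<_; _≤_; _⊔_; s≤s; z≤n)
open import Data.Nat.Properties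
  using (+-assoc; +-identityʳ; +-comm; +-suc; +-cancelˡ-≡; ≤-trans; m≤m⊔n; m≤n⊔m; <⇒≢; <⇒≱; m∸n+n≡m; m≤m+n; m≤n+m; m≤m*n)
open import Data.Nat.DivMod using (_%_; m%n<n; [m+kn]%n≡m%n; m<n⇒m%n≡m)
open import Data.Fin as F using (Fin; toℕ)
open import Data.Fin.Properties using (2↔Bool; *↔×; toℕ-injective; toℕ<n; toℕ-fromℕ<)
open import Data.Product as Product using (Σ; _×_; _,_; proj₁; proj₂)
open import Data.Product.Function.NonDependent.Propositional using (_×-↔_)
open import Data.Sum as Sum using (_⊎_; inj₁; inj₂)
open import Data.List using (List; []; _∷_; _++_; length; lookup)
open import Data.List.Membership.Propositional using (_∈_)
open import Data.List.Membership.Propositional.Properties using (∈-++⁻; ∈-++⁺ˡ; ∈-++⁺ʳ; ∈-lookup)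
open import Data.List.Relation.Unary.Any using (here; there; index)
open import Data.List.Relation.Unary.Any.Properties using (lookup-index)
open import Function using (_∘_; id; case_of_)
open import Function.Bundles using (_↣_; _↔_; Injection; Inverse)
open import Function.Construct.Composition using (_↔-∘_)
open import Relation.Nullary using (¬_; yes; no; does)
open import Relation.Nullary.Decidable using (dec-true)
open import Relation.Binary.PropositionalEquality
  using (_≡_; _≢_; refl; sym; trans; cong; cong₂; subst; subst₂; module ≡-Reasoning)

-- Every QCTL* formula Φ is translated into a QCTL formula that agrees with Φ on EVERY Kripke
-- structure (reasoning classically); structure semantics is the instance of a finite structure,
-- tree semantics that of its unwinding.  The only non-trivial case is E ψ.  Fresh "markers",
-- one per Hintikka label of ψ (truth values for its subformulas), are quantified so as to mark
-- each state of a path with the label of the suffix starting there.  QCTL checks that marked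
-- states are described correctly by their labels, that successive labels respect the one-step
-- unfolding of X and U, and -- expressing reachability as a least fixpoint with a second set of
-- markers -- that every pending until is eventually fulfilled.  Soundness marks a witness path;
-- completeness extracts a path from a marking by a fair round-robin schedule over the pending
-- untils, and a truth lemma shows that every label on it tells the truth.

-- Logical equivalence, as in Defs (whose `_⇔_` carries an irrelevant implicit argument).
_⟺_ : Set → Set → Set
_⟺_ = _⇔_ {⊤}

module Classical (lem : ExcludedMiddle 0ℓ) where

  ¬¬-elim : {P : Set} → ¬ ¬ P → P
  ¬¬-elim {P} ¬¬p with lem {P}
  ... | yes p = p
  ... | no ¬p = ⊥-elim (¬¬p ¬p)

  by-cases : {P R : Set} → (P → R) → (¬ P → R) → R
  by-cases {P} yes-case no-case with lem {P}
  ... | yes p  = yes-case p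
  ... | no ¬p = no-case ¬p

  ⟦_⟧ : Set → Bool
  ⟦ P ⟧ = does (lem {P})

  ⟦⟧-intro : {P : Set} → P → ⟦ P ⟧ ≡ true
  ⟦⟧-intro = dec-true lem

  ⟦⟧-elim : {P : Set} → ⟦ P ⟧ ≡ true → P
  ⟦⟧-elim {P} e with lem {P}
  ... | yes p = p
  ⟦⟧-elim {P} () | no _

  ⟦⟧-char : {P : Set} (b : Bool) → (b ≡ true → P) → (P → b ≡ true) → b ≡ ⟦ P ⟧
  ⟦⟧-char {P} b to from with lem {P}
  ⟦⟧-char true  to from | no ¬p = ⊥-elim (¬p (to refl))
  ⟦⟧-char false to from | no ¬p = refl
  ⟦⟧-char b     to from | yes p = from p

  ⟦⟧-cong : {P P' : Set} → (P → P') → (P' → P) → ⟦ P ⟧ ≡ ⟦ P' ⟧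
  ⟦⟧-cong to from = ⟦⟧-char _ (to ∘ ⟦⟧-elim) (⟦⟧-intro ∘ from)

  override : {Q A : Set} (P : A → Set) (new old : Q → A → Bool) → Q → A → Bool
  override P new old s a with lem {P a}
  ... | yes _ = new s a
  ... | no  _ = old s a

  override-in : {Q A : Set} (P : A → Set) (new old : Q → A → Bool) {s : Q} {a : A} →
                P a → override P new old s a ≡ new s a
  override-in P new old {s} {a} pa with lem {P a}
  ... | yes _  = refl
  ... | no ¬pa = ⊥-elim (¬pa pa)

  override-out : {Q A : Set} (P : A → Set) (new old : Q → A → Bool) {s : Q} {a : A} →
                 ¬ P a → override P new old s a ≡ old s a
  override-out P new old {s} {a} ¬pa with lem {P a}
  ... | yes pa = ⊥-elim (¬pa pa)
  ... | no  _  = refl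

module Paths (AP : Set) where
  open Syntax AP
  open Kripke
  open Path

  pathFrom : (K : Kripke AP) → Q K → Path K
  pathFrom K s = record { seq = walk ; step = λ i → proj₂ (total K (walk i)) }
    where
    walk : ℕ → Q K
    walk zero    = s
    walk (suc i) = proj₁ (total K (walk i))

  prepend : (K : Kripke AP) (s : Q K) (ρ : Path K) → R K s (seq ρ 0) → Path K
  prepend K s ρ r = record { seq = states ; step = steps }
    where
    states : ℕ → Q K
    states zero    = s
    states (suc i) = seq ρ i
    steps : ∀ i → R K (states i) (states (suc i))
    steps zero    = r
    steps (suc i) = step ρ i

  record _≈_ {K : Kripke AP} (ρ ρ' : Path K) : Set where
    constructor pointwise
    field at : ∀ i → seq ρ i ≡ seq ρ' i
  open _≈_

  ≈-sym : {K : Kripke AP} {ρ ρ' : Path K} → ρ ≈ ρ' → ρ' ≈ ρ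
  ≈-sym e = pointwise λ i → sym (at e i)

  suffix-≈ : {K : Kripke AP} {ρ ρ' : Path K} → ρ ≈ ρ' → ∀ k → suffix k ρ ≈ suffix k ρ'
  suffix-≈ e k = pointwise λ i → at e (i + k)

  suffix-suffix : {K : Kripke AP} (ρ : Path K) (i n : ℕ) → suffix i (suffix n ρ) ≈ suffix (i + n) ρ
  suffix-suffix ρ i n = pointwise λ x → cong (seq ρ) (+-assoc x i n)

  suffix-zero : {K : Kripke AP} (ρ : Path K) → suffix 0 ρ ≈ ρ
  suffix-zero ρ = pointwise λ x → cong (seq ρ) (+-identityʳ x)

  suffix-one : {K : Kripke AP} (ρ : Path K) (i : ℕ) → suffix i (suffix 1 ρ) ≈ suffix (suc i) ρ
  suffix-one ρ i = pointwise λ x → cong (seq ρ) (trans (+-assoc x i 1) (cong (x +_) (+-comm i 1)))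

  sat-≈ : {K : Kripke AP} (χ : PathF) {ρ ρ' : Path K} → ρ ≈ ρ' → K , ρ ⊨ₚ χ → K , ρ' ⊨ₚ χ
  sat-≈ (st φ) e h = subst (λ s → _ , s ⊨ₛ φ) (at e 0) h
  sat-≈ (¬ₚ χ) e h h' = h (sat-≈ χ (≈-sym e) h')
  sat-≈ (χ ∨ₚ χ') e (inj₁ h) = inj₁ (sat-≈ χ e h)
  sat-≈ (χ ∨ₚ χ') e (inj₂ h) = inj₂ (sat-≈ χ' e h)
  sat-≈ (X χ) e h = sat-≈ χ (suffix-≈ e 1) h
  sat-≈ (χ U χ') e (i , h' , h) = i , sat-≈ χ' (suffix-≈ e i) h' , λ j j<i → sat-≈ χ (suffix-≈ e j) (h j j<i)

  until-unfold : {K : Kripke AP} (χ χ' : PathF) (ρ : Path K) → K , ρ ⊨ₚ (χ U χ') →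
                 (K , ρ ⊨ₚ χ') ⊎ ((K , ρ ⊨ₚ χ) × (K , suffix 1 ρ ⊨ₚ (χ U χ')))
  until-unfold χ χ' ρ (zero , h' , h) = inj₁ (sat-≈ χ' (suffix-zero ρ) h')
  until-unfold χ χ' ρ (suc i , h' , h) =
    inj₂ ( sat-≈ χ (suffix-zero ρ) (h 0 (s≤s z≤n))
         , i , sat-≈ χ' (≈-sym (suffix-one ρ i)) h'
         , λ j j<i → sat-≈ χ (≈-sym (suffix-one ρ j)) (h (suc j) (s≤s j<i)) )

  until-fold : {K : Kripke AP} (χ χ' : PathF) (ρ : Path K) →
               (K , ρ ⊨ₚ χ') ⊎ ((K , ρ ⊨ₚ χ) × (K , suffix 1 ρ ⊨ₚ (χ U χ'))) → K , ρ ⊨ₚ (χ U χ')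
  until-fold χ χ' ρ (inj₁ h') = zero , sat-≈ χ' (≈-sym (suffix-zero ρ)) h' , λ _ ()
  until-fold χ χ' ρ (inj₂ (h , i , h' , hs)) =
    suc i , sat-≈ χ' (suffix-one ρ i) h' ,
    λ { zero    _         → sat-≈ χ (≈-sym (suffix-zero ρ)) h
      ; (suc j) (s≤s j<i) → sat-≈ χ (suffix-one ρ j) (hs j j<i) }

module Locality (lem : ExcludedMiddle 0ℓ) (AP : Set) where
  open Syntax AP
  open Kripke
  open Path
  open Classical lem

  mutual
    OccS : AP → StateF → Set
    OccS a (atom x) = a ≡ x
    OccS a (¬ₛ φ)   = OccS a φ
    OccS a (φ ∨ₛ φ') = OccS a φ ⊎ OccS a φ'
    OccS a (E χ)    = OccP a χ
    OccS a (∃ₚ x φ) = (a ≡ x) ⊎ OccS a φ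

    OccP : AP → PathF → Set
    OccP a (st φ)    = OccS a φ
    OccP a (¬ₚ χ)    = OccP a χ
    OccP a (χ ∨ₚ χ') = OccP a χ ⊎ OccP a χ'
    OccP a (X χ)     = OccP a χ
    OccP a (χ U χ')  = OccP a χ ⊎ OccP a χ'

  AgreeOn : (K : Kripke AP) → (Q K → AP → Bool) → (Q K → AP → Bool) → (AP → Set) → Set
  AgreeOn K ℓ₁ ℓ₂ P = ∀ s a → P a → ℓ₁ s a ≡ ℓ₂ s a

  relabelPath : (K : Kripke AP) (ℓ₁ ℓ₂ : Q K → AP → Bool) → Path (relabel K ℓ₁) → Path (relabel K ℓ₂)
  relabelPath K ℓ₁ ℓ₂ ρ = record { seq = seq ρ ; step = step ρ }

  mutual
    locality : (K : Kripke AP) (ℓ₁ ℓ₂ : Q K → AP → Bool) (φ : StateF) →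
               AgreeOn K ℓ₁ ℓ₂ (λ a → OccS a φ) → ∀ s → relabel K ℓ₁ , s ⊨ₛ φ → relabel K ℓ₂ , s ⊨ₛ φ
    locality K ℓ₁ ℓ₂ (atom x) ag s h = trans (sym (ag s x refl)) h
    locality K ℓ₁ ℓ₂ (¬ₛ φ) ag s h h' = h (locality K ℓ₂ ℓ₁ φ (λ s a o → sym (ag s a o)) s h')
    locality K ℓ₁ ℓ₂ (φ ∨ₛ φ') ag s (inj₁ h) = inj₁ (locality K ℓ₁ ℓ₂ φ (λ s a o → ag s a (inj₁ o)) s h)
    locality K ℓ₁ ℓ₂ (φ ∨ₛ φ') ag s (inj₂ h) = inj₂ (locality K ℓ₁ ℓ₂ φ' (λ s a o → ag s a (inj₂ o)) s h)
    locality K ℓ₁ ℓ₂ (E χ) ag s (ρ , e , h) = relabelPath K ℓ₁ ℓ₂ ρ , e , localityₚ K ℓ₁ ℓ₂ χ ag ρ h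
    locality K ℓ₁ ℓ₂ (∃ₚ x φ) ag s (ℓ' , ℓ'≈ℓ₁ , h) =
      ℓ'' , (λ _ _ a≢x → override-out (_≡ x) ℓ' ℓ₂ a≢x) , locality K ℓ' ℓ'' φ ℓ'≈ℓ'' s h
      where
      ℓ'' : Q K → AP → Bool
      ℓ'' = override (_≡ x) ℓ' ℓ₂
      ℓ'≈ℓ'' : AgreeOn K ℓ' ℓ'' (λ a → OccS a φ)
      ℓ'≈ℓ'' s a o = by-cases
        (λ a≡x → sym (override-in (_≡ x) ℓ' ℓ₂ a≡x))
        (λ a≢x → trans (ℓ'≈ℓ₁ s a a≢x) (trans (ag s a (inj₂ o)) (sym (override-out (_≡ x) ℓ' ℓ₂ a≢x))))

    localityₚ : (K : Kripke AP) (ℓ₁ ℓ₂ : Q K → AP → Bool) (χ : PathF) →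
                AgreeOn K ℓ₁ ℓ₂ (λ a → OccP a χ) → (ρ : Path (relabel K ℓ₁)) →
                relabel K ℓ₁ , ρ ⊨ₚ χ → relabel K ℓ₂ , relabelPath K ℓ₁ ℓ₂ ρ ⊨ₚ χ
    localityₚ K ℓ₁ ℓ₂ (st φ) ag ρ h = locality K ℓ₁ ℓ₂ φ ag (seq ρ 0) h
    localityₚ K ℓ₁ ℓ₂ (¬ₚ χ) ag ρ h h' =
      h (localityₚ K ℓ₂ ℓ₁ χ (λ s a o → sym (ag s a o)) (relabelPath K ℓ₁ ℓ₂ ρ) h')
    localityₚ K ℓ₁ ℓ₂ (χ ∨ₚ χ') ag ρ (inj₁ h) = inj₁ (localityₚ K ℓ₁ ℓ₂ χ (λ s a o → ag s a (inj₁ o)) ρ h)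
    localityₚ K ℓ₁ ℓ₂ (χ ∨ₚ χ') ag ρ (inj₂ h) = inj₂ (localityₚ K ℓ₁ ℓ₂ χ' (λ s a o → ag s a (inj₂ o)) ρ h)
    localityₚ K ℓ₁ ℓ₂ (X χ) ag ρ h = localityₚ K ℓ₁ ℓ₂ χ ag (suffix 1 ρ) h
    localityₚ K ℓ₁ ℓ₂ (χ U χ') ag ρ (i , h' , h) =
      i , localityₚ K ℓ₁ ℓ₂ χ' (λ s a o → ag s a (inj₂ o)) (suffix i ρ) h' ,
      λ j j<i → localityₚ K ℓ₁ ℓ₂ χ (λ s a o → ag s a (inj₁ o)) (suffix j ρ) (h j j<i)

module Freshness (lem : ExcludedMiddle 0ℓ) (AP : Set) (inj : ℕ ↣ AP) where
  open Syntax AP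
  open Locality lem AP

  p : ℕ → AP
  p = Injection.to inj

  p-injective : ∀ {m n} → p m ≡ p n → m ≡ n
  p-injective = Injection.injective inj

  record FreshFrom (B : ℕ) (P : AP → Set) : Set where
    constructor freshFrom
    field fresh : ∀ n → B ≤ n → ¬ P (p n)
  open FreshFrom public

  fresh-mono : ∀ {B} {P₁ P₂ : AP → Set} → (∀ {a} → P₁ a → P₂ a) → FreshFrom B P₂ → FreshFrom B P₁
  fresh-mono sub f = freshFrom λ n le o → fresh f n le (sub o)

  join : {P₁ P₂ : AP → Set} → Σ ℕ (λ B → FreshFrom B P₁) → Σ ℕ (λ B → FreshFrom B P₂) →
         Σ ℕ λ B → FreshFrom B (λ a → P₁ a ⊎ P₂ a)
  join (B₁ , f₁) (B₂ , f₂) = B₁ ⊔ B₂ , freshFrom λ where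
    n le (inj₁ o) → fresh f₁ n (≤-trans (m≤m⊔n B₁ B₂) le) o
    n le (inj₂ o) → fresh f₂ n (≤-trans (m≤n⊔m B₁ B₂) le) o

  -- an atom x is p n for at most one n, since p is injective
  fresh-atom : (x : AP) → Σ ℕ λ B → FreshFrom B (_≡ x)
  fresh-atom x with lem {Σ ℕ λ n → p n ≡ x}
  ... | yes (n₀ , e) = suc n₀ , freshFrom λ n le e' → <⇒≢ le (sym (p-injective (trans e' (sym e))))
  ... | no ¬e        = 0 , freshFrom λ n _ e' → ¬e (n , e')

  mutual
    freshS : (φ : StateF) → Σ ℕ λ B → FreshFrom B (λ a → OccS a φ)
    freshS (atom x) = fresh-atom x
    freshS (¬ₛ φ) = freshS φ
    freshS (φ ∨ₛ φ') = join (freshS φ) (freshS φ')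
    freshS (E χ) = freshP χ
    freshS (∃ₚ x φ) = join (fresh-atom x) (freshS φ)

    freshP : (χ : PathF) → Σ ℕ λ B → FreshFrom B (λ a → OccP a χ)
    freshP (st φ) = freshS φ
    freshP (¬ₚ χ) = freshP χ
    freshP (χ ∨ₚ χ') = join (freshP χ) (freshP χ')
    freshP (X χ) = freshP χ
    freshP (χ U χ') = join (freshP χ) (freshP χ')

-- Derived QCTL connectives and their semantics on an arbitrary Kripke structure.
-- Any proposition a₀ serves to build the constant true.
module Connectives (lem : ExcludedMiddle 0ℓ) (AP : Set) (a₀ : AP) where
  open Syntax AP
  open Kripke
  open Path
  open Classical lem
  open Paths AP
  open Locality lem AP

  -- Satisfaction of a QCTL formula (a record, so that θ can be inferred).
  record _,_⊨q_ (K : Kripke AP) (s : Q K) (θ : QCTL) : Set where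
    constructor ⟨_⟩
    field un : K , s ⊨ₛ embed θ
  open _,_⊨q_ public

  ⊤q ⊥q : QCTL
  ⊤q = atom a₀ ∨q (¬q atom a₀)
  ⊥q = ¬q ⊤q

  _∧q_ _⇒q_ : QCTL → QCTL → QCTL
  θ ∧q θ' = ¬q ((¬q θ) ∨q (¬q θ'))
  θ ⇒q θ' = (¬q θ) ∨q θ'

  const : Bool → QCTL
  const true  = ⊤q
  const false = ⊥q

  AG : QCTL → QCTL
  AG θ = ¬q (EU ⊤q (¬q θ))

  ⋀ ⋁ : ∀ n → (Fin n → QCTL) → QCTL
  ⋀ zero    f = ⊤q
  ⋀ (suc n) f = f F.zero ∧q ⋀ n (f ∘ F.suc)
  ⋁ zero    f = ⊥q
  ⋁ (suc n) f = f F.zero ∨q ⋁ n (f ∘ F.suc)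

  ∃⃗ : ∀ n → (Fin n → AP) → QCTL → QCTL
  ∃⃗ zero    x θ = θ
  ∃⃗ (suc n) x θ = ∃q (x F.zero) (∃⃗ n (x ∘ F.suc) θ)

  module _ {K : Kripke AP} {s : Q K} where

    ⊤-sat : K , s ⊨q ⊤q
    ⊤-sat = by-cases (λ x → ⟨ inj₁ x ⟩) (λ ¬x → ⟨ inj₂ ¬x ⟩)

    ¬-sat : {θ : QCTL} → K , s ⊨q (¬q θ) → ¬ (K , s ⊨q θ)
    ¬-sat ⟨ h ⟩ ⟨ x ⟩ = h x

    sat-¬ : {θ : QCTL} → ¬ (K , s ⊨q θ) → K , s ⊨q (¬q θ)
    sat-¬ h = ⟨ (λ x → h ⟨ x ⟩) ⟩

    ∧-sat : {θ θ' : QCTL} → K , s ⊨q (θ ∧q θ') → (K , s ⊨q θ) × (K , s ⊨q θ')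
    ∧-sat ⟨ h ⟩ = ⟨ ¬¬-elim (λ ¬x → h (inj₁ ¬x)) ⟩ , ⟨ ¬¬-elim (λ ¬y → h (inj₂ ¬y)) ⟩

    sat-∧ : {θ θ' : QCTL} → K , s ⊨q θ → K , s ⊨q θ' → K , s ⊨q (θ ∧q θ')
    sat-∧ ⟨ x ⟩ ⟨ y ⟩ = ⟨ (λ { (inj₁ ¬x) → ¬x x ; (inj₂ ¬y) → ¬y y }) ⟩

    ⇒-sat : {θ θ' : QCTL} → K , s ⊨q (θ ⇒q θ') → K , s ⊨q θ → K , s ⊨q θ'
    ⇒-sat ⟨ inj₁ ¬x ⟩ ⟨ x ⟩ = ⊥-elim (¬x x)
    ⇒-sat ⟨ inj₂ y ⟩  _     = ⟨ y ⟩

    sat-⇒ : {θ θ' : QCTL} → (K , s ⊨q θ → K , s ⊨q θ') → K , s ⊨q (θ ⇒q θ')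
    sat-⇒ f = by-cases (λ x → ⟨ inj₂ (un (f ⟨ x ⟩)) ⟩) (λ ¬x → ⟨ inj₁ ¬x ⟩)

    const-sat : ∀ b → K , s ⊨q const b → b ≡ true
    const-sat true  _ = refl
    const-sat false h = ⊥-elim (¬-sat h ⊤-sat)

    sat-const : ∀ {b} → b ≡ true → K , s ⊨q const b
    sat-const refl = ⊤-sat

  ⋀-sat : ∀ {K s} n f → K , s ⊨q ⋀ n f → ∀ k → K , s ⊨q f k
  ⋀-sat (suc n) f h F.zero    = proj₁ (∧-sat h)
  ⋀-sat (suc n) f h (F.suc k) = ⋀-sat n (f ∘ F.suc) (proj₂ (∧-sat h)) k

  sat-⋀ : ∀ {K s} n f → (∀ k → K , s ⊨q f k) → K , s ⊨q ⋀ n f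
  sat-⋀ zero    f h = ⊤-sat
  sat-⋀ (suc n) f h = sat-∧ (h F.zero) (sat-⋀ n (f ∘ F.suc) (h ∘ F.suc))

  ⋁-sat : ∀ {K s} n f → K , s ⊨q ⋁ n f → Σ (Fin n) λ k → K , s ⊨q f k
  ⋁-sat zero    f h = ⊥-elim (¬-sat h ⊤-sat)
  ⋁-sat (suc n) f ⟨ inj₁ h ⟩ = F.zero , ⟨ h ⟩
  ⋁-sat (suc n) f ⟨ inj₂ h ⟩ with ⋁-sat n (f ∘ F.suc) ⟨ h ⟩
  ... | k , h' = F.suc k , h'

  sat-⋁ : ∀ {K s} n f k → K , s ⊨q f k → K , s ⊨q ⋁ n f
  sat-⋁ (suc n) f F.zero    ⟨ h ⟩ = ⟨ inj₁ h ⟩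
  sat-⋁ (suc n) f (F.suc k) h     = ⟨ inj₂ (un (sat-⋁ n (f ∘ F.suc) k h)) ⟩

  EX-sat : ∀ {K s θ} → K , s ⊨q EX θ → Σ (Q K) λ s' → R K s s' × K , s' ⊨q θ
  EX-sat ⟨ ρ , refl , h ⟩ = seq ρ 1 , step ρ 0 , ⟨ h ⟩

  sat-EX : ∀ {K s θ} s' → R K s s' → K , s' ⊨q θ → K , s ⊨q EX θ
  sat-EX {K} {s} s' r ⟨ h ⟩ = ⟨ prepend K s (pathFrom K s') r , refl , h ⟩

  Globally : (K : Kripke AP) → Q K → (Q K → Set) → Set
  Globally K s P = ∀ (ρ : Path K) → seq ρ 0 ≡ s → ∀ i → P (seq ρ i)

  AG-sat : ∀ {K s θ} → K , s ⊨q AG θ → Globally K s (λ s' → K , s' ⊨q θ)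
  AG-sat {K} ⟨ h ⟩ ρ e i = ⟨ ¬¬-elim (λ ¬θ → h (ρ , e , i , ¬θ , λ j _ → un (⊤-sat {K} {seq ρ j}))) ⟩

  sat-AG : ∀ {K s θ} → Globally K s (λ s' → K , s' ⊨q θ) → K , s ⊨q AG θ
  sat-AG h = ⟨ (λ { (ρ , e , i , ¬θ , _) → ¬θ (un (h ρ e i)) }) ⟩

  Globally-here : ∀ {K s P} → Globally K s P → P s
  Globally-here {K} {s} h = h (pathFrom K s) refl 0

  Globally-step : ∀ {K s s' P} → Globally K s P → R K s s' → Globally K s' P
  Globally-step {K} {s} h r ρ refl i = h (prepend K s ρ r) refl (suc i)

  Outside : ∀ n → (Fin n → AP) → AP → Set
  Outside n x a = ∀ k → a ≢ x k

  ∃⃗-sat : ∀ {K s} n x θ → K , s ⊨q ∃⃗ n x θ →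
          Σ (Q K → AP → Bool) λ ℓ' → (∀ s a → Outside n x a → ℓ' s a ≡ ℓ K s a) × relabel K ℓ' , s ⊨q θ
  ∃⃗-sat {K} zero x θ h = ℓ K , (λ _ _ _ → refl) , h
  ∃⃗-sat {K} (suc n) x θ ⟨ ℓ₁ , ℓ₁≈ℓ , h ⟩ with ∃⃗-sat {relabel K ℓ₁} n (x ∘ F.suc) θ ⟨ h ⟩
  ... | ℓ₂ , ℓ₂≈ℓ₁ , h₂ = ℓ₂ , (λ s a out → trans (ℓ₂≈ℓ₁ s a (out ∘ F.suc)) (ℓ₁≈ℓ s a (out F.zero))) , h₂

  sat-∃⃗ : ∀ {K s} n x θ (ℓ' : Q K → AP → Bool) → (∀ s a → Outside n x a → ℓ' s a ≡ ℓ K s a) →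
          relabel K ℓ' , s ⊨q θ → K , s ⊨q ∃⃗ n x θ
  sat-∃⃗ {K} {s} zero x θ ℓ' ℓ'≈ℓ ⟨ h ⟩ = ⟨ locality K ℓ' (ℓ K) (embed θ) (λ s a _ → ℓ'≈ℓ s a (λ ())) s h ⟩
  sat-∃⃗ {K} {s} (suc n) x θ ℓ' ℓ'≈ℓ h = ⟨ ℓ₁ , (λ _ _ → override-out (_≡ x F.zero) ℓ' (ℓ K)) , un rest ⟩
    where
    ℓ₁ : Q K → AP → Bool
    ℓ₁ = override (_≡ x F.zero) ℓ' (ℓ K)
    ℓ'≈ℓ₁ : ∀ s a → Outside n (x ∘ F.suc) a → ℓ' s a ≡ ℓ₁ s a
    ℓ'≈ℓ₁ s a out = by-cases
      (λ a≡x₀ → sym (override-in (_≡ x F.zero) ℓ' (ℓ K) a≡x₀))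
      (λ a≢x₀ → trans (ℓ'≈ℓ s a λ { F.zero → a≢x₀ ; (F.suc k) → out k })
                       (sym (override-out (_≡ x F.zero) ℓ' (ℓ K) a≢x₀)))
    rest : relabel K ℓ₁ , s ⊨q ∃⃗ n (x ∘ F.suc) θ
    rest = sat-∃⃗ {relabel K ℓ₁} n (x ∘ F.suc) θ ℓ' ℓ'≈ℓ₁ h

module BoolTruth where

  true≢false : true ≢ false
  true≢false ()

  ∧-true : ∀ {x y} → x ∧ y ≡ true → x ≡ true × y ≡ true
  ∧-true {true} {true} _ = refl , refl

  true-∧ : ∀ {x y} → x ≡ true → y ≡ true → x ∧ y ≡ true
  true-∧ refl refl = refl

  ∨-true : ∀ {x y} → x ∨ y ≡ true → x ≡ true ⊎ y ≡ true
  ∨-true {true}  _ = inj₁ refl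
  ∨-true {false} e = inj₂ e

  true-∨ : ∀ {x y} → x ≡ true ⊎ y ≡ true → x ∨ y ≡ true
  true-∨ {true}  _        = refl
  true-∨ {false} (inj₂ e) = e

  not-true : ∀ {x} → not x ≡ true → ¬ (x ≡ true)
  not-true {false} _ ()

  true-not : ∀ {x} → ¬ (x ≡ true) → not x ≡ true
  true-not {true}  n = ⊥-elim (n refl)
  true-not {false} _ = refl

  _==_ : Bool → Bool → Bool
  true  == y = y
  false == y = not y

  ==-true : ∀ {x y} → x == y ≡ true → x ≡ y
  ==-true {true}  {true}  _ = refl
  ==-true {false} {false} _ = refl

  true-== : ∀ {x y} → x ≡ y → x == y ≡ true
  true-== {true}  refl = refl
  true-== {false} refl = refl

-- Suppose flag n, a n, b n satisfy the fixpoint equation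
-- flag n = b n ∨ (a n ∧ flag (n+1)) of  a U b.  Then a U b holding at n forces flag n, and the
-- converse holds provided every eventually-raised flag is eventually discharged by some b.
module UntilSeq (flag a b : ℕ → Bool) (unfold : ∀ n → flag n ≡ b n ∨ (a n ∧ flag (suc n))) where
  open BoolTruth

  Until : ℕ → Set
  Until n = Σ ℕ λ i → (b (i + n) ≡ true) × (∀ j → j < i → a (j + n) ≡ true)

  until⇒flag : ∀ i n → b (i + n) ≡ true → (∀ j → j < i → a (j + n) ≡ true) → flag n ≡ true
  until⇒flag zero    n bn _  = trans (unfold n) (true-∨ (inj₁ bn))
  until⇒flag (suc i) n bi as =
    trans (unfold n) (true-∨ {b n} (inj₂ (true-∧ (as 0 (s≤s z≤n)) (until⇒flag i (suc n) bi' as'))))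
    where
    bi' : b (i + suc n) ≡ true
    bi' = subst (λ z → b z ≡ true) (sym (+-suc i n)) bi
    as' : ∀ j → j < i → a (j + suc n) ≡ true
    as' j j<i = subst (λ z → a z ≡ true) (sym (+-suc j n)) (as (suc j) (s≤s j<i))

  flag-step : ∀ n → flag n ≡ true → b n ≡ false → a n ≡ true × flag (suc n) ≡ true
  flag-step n fn bn = ∧-true (subst (λ z → z ∨ (a n ∧ flag (suc n)) ≡ true) bn (trans (sym (unfold n)) fn))

  until-cons : ∀ n → a n ≡ true → Until (suc n) → Until n
  until-cons n an (i , bi , as) = suc i , subst (λ z → b z ≡ true) (+-suc i n) bi ,
    λ { zero _ → an ; (suc j) (s≤s j<i) → subst (λ z → a z ≡ true) (+-suc j n) (as j j<i) }

  flag-discharged : ∀ d n → flag n ≡ true → b (d + n) ≡ true → Until n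
  flag-discharged d n fn bd with b n in bn
  ... | true = 0 , bn , λ _ ()
  ... | false with flag-step n fn bn
  flag-discharged zero    n fn bd | false | _ = ⊥-elim (true≢false (trans (sym bd) bn))
  flag-discharged (suc d) n fn bd | false | an , fn' =
    until-cons n an (flag-discharged d (suc n) fn' (subst (λ z → b z ≡ true) (sym (+-suc d n)) bd))

  flag-persists : ∀ d n → flag n ≡ true → Until n ⊎ flag (d + n) ≡ true
  flag-persists d n fn with b n in bn
  ... | true = inj₁ (0 , bn , λ _ ())
  ... | false with flag-step n fn bn
  flag-persists zero    n fn | false | _ = inj₂ fn
  flag-persists (suc d) n fn | false | an , fn' with flag-persists d (suc n) fn'
  ... | inj₁ u = inj₁ (until-cons n an u)
  ... | inj₂ f = inj₂ (subst (λ z → flag z ≡ true) (+-suc d n) f)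

  Fair : Set
  Fair = ∀ n → Σ ℕ λ K → (n ≤ K) × (flag K ≡ true → Σ ℕ λ K' → (K ≤ K') × (b K' ≡ true))

  flag⇒until : Fair → ∀ n → flag n ≡ true → Until n
  flag⇒until fair n fn with fair n
  ... | K , n≤K , discharge with flag-persists (K ∸ n) n fn
  ... | inj₁ u = u
  ... | inj₂ fK with discharge (subst (λ z → flag z ≡ true) (m∸n+n≡m n≤K) fK)
  ... | K' , K≤K' , bK' =
    flag-discharged (K' ∸ n) n fn (subst (λ z → b z ≡ true) (sym (m∸n+n≡m (≤-trans n≤K K≤K'))) bK')

Finite : Set → Set
Finite A = Σ ℕ λ n → Fin n ↔ A

finite-Bool : Finite Bool
finite-Bool = 2 , 2↔Bool

finite-× : {A B : Set} → Finite A → Finite B → Finite (A × B)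
finite-× (m , eA) (n , eB) = m * n , (eA ×-↔ eB) ↔-∘ *↔×

-- Hintikka labels of a path formula ψ: truth values for every X- and U-subformula and for the
-- maximal state subformulas of ψ, arranged along its syntax tree.  A path is encoded by
-- marking each of its positions with the label that describes the suffix starting there.
module Hintikka (AP : Set) where
  open Syntax AP
  open BoolTruth

  Hint : PathF → Set
  Hint (st φ)    = Bool
  Hint (¬ₚ χ)    = Hint χ
  Hint (χ ∨ₚ χ') = Hint χ × Hint χ'
  Hint (X χ)     = Bool × Hint χ
  Hint (χ U χ')  = Bool × (Hint χ × Hint χ')

  finite-Hint : ∀ χ → Finite (Hint χ)
  finite-Hint (st φ)    = finite-Bool
  finite-Hint (¬ₚ χ)    = finite-Hint χ
  finite-Hint (χ ∨ₚ χ') = finite-× (finite-Hint χ) (finite-Hint χ')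
  finite-Hint (X χ)     = finite-× finite-Bool (finite-Hint χ)
  finite-Hint (χ U χ')  = finite-× finite-Bool (finite-× (finite-Hint χ) (finite-Hint χ'))

  holds : ∀ χ → Hint χ → Bool
  holds (st φ)    t        = t
  holds (¬ₚ χ)    t        = not (holds χ t)
  holds (χ ∨ₚ χ') (t , t') = holds χ t ∨ holds χ' t'
  holds (X χ)     (c , _)  = c
  holds (χ U χ')  (c , _)  = c

  -- t' may label the position after one labelled t: X-flags announce the next truth value and
  -- U-flags satisfy the unfolding  χ U χ' = χ' ∨ (χ ∧ X (χ U χ')).
  next : ∀ χ → Hint χ → Hint χ → Bool
  next (st φ)    _               _                  = true
  next (¬ₚ χ)    t               u                  = next χ t u
  next (χ ∨ₚ χ') (t , t')        (u , u')           = next χ t u ∧ next χ' t' u'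
  next (X χ)     (c , t)         (c' , u)           = (c == holds χ u) ∧ next χ t u
  next (χ U χ')  (c , t , t')    (c' , u , u')      =
    (c == (holds χ' t' ∨ (holds χ t ∧ c'))) ∧ next χ t u ∧ next χ' t' u'

  -- The one-step rule `next` cannot prevent a U-flag from being postponed forever; these are
  -- the eventualities whose fulfilment the encoding must enforce separately.
  record UntilNode (ψ : PathF) : Set where
    constructor untilNode
    field
      left right : PathF
      project    : Hint ψ → Hint (left U right)

  module _ {ψ : PathF} (u : UntilNode ψ) where
    open UntilNode u

    pending goal : Hint ψ → Bool
    pending t = proj₁ (project t)
    goal    t = holds right (proj₂ (proj₂ (project t)))

  untilNodes : (ψ χ : PathF) → (Hint ψ → Hint χ) → List (UntilNode ψ)
  untilNodes ψ (st φ)    π = []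
  untilNodes ψ (¬ₚ χ)    π = untilNodes ψ χ π
  untilNodes ψ (χ ∨ₚ χ') π = untilNodes ψ χ (proj₁ ∘ π) ++ untilNodes ψ χ' (proj₂ ∘ π)
  untilNodes ψ (X χ)     π = untilNodes ψ χ (proj₂ ∘ π)
  untilNodes ψ (χ U χ')  π =
    untilNode χ χ' π ∷ (untilNodes ψ χ (proj₁ ∘ proj₂ ∘ π) ++ untilNodes ψ χ' (proj₂ ∘ proj₂ ∘ π))

  -- A node that is never pending, so that the list of eventualities is never empty.
  idle : {ψ : PathF} → UntilNode ψ
  idle {ψ} = untilNode ψ ψ (λ t → false , t , t)

  eventualities : (ψ : PathF) → List (UntilNode ψ)
  eventualities ψ = idle ∷ untilNodes ψ ψ id

module PathLabels (lem : ExcludedMiddle 0ℓ) (AP : Set) where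
  open Syntax AP
  open Kripke
  open Path
  open Classical lem
  open Paths AP
  open Locality lem AP
  open Hintikka AP
  open BoolTruth

  Matches : (K : Kripke AP) (χ : PathF) → Hint χ → Q K → Set
  Matches K (st φ)    b        s = (b ≡ true → K , s ⊨ₛ φ) × (K , s ⊨ₛ φ → b ≡ true)
  Matches K (¬ₚ χ)    t        s = Matches K χ t s
  Matches K (χ ∨ₚ χ') (t , t') s = Matches K χ t s × Matches K χ' t' s
  Matches K (X χ)     (_ , t)  s = Matches K χ t s
  Matches K (χ U χ')  (_ , t , t') s = Matches K χ t s × Matches K χ' t' s

  Matches-locality : (K : Kripke AP) (χ : PathF) (ℓ₁ ℓ₂ : Q K → AP → Bool) →
                     AgreeOn K ℓ₁ ℓ₂ (λ a → OccP a χ) → ∀ t s →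
                     Matches (relabel K ℓ₁) χ t s → Matches (relabel K ℓ₂) χ t s
  Matches-locality K (st φ) ℓ₁ ℓ₂ ag t s (to , from) =
    (λ e → locality K ℓ₁ ℓ₂ φ ag s (to e)) , (λ h → from (locality K ℓ₂ ℓ₁ φ (λ s a o → sym (ag s a o)) s h))
  Matches-locality K (¬ₚ χ) ℓ₁ ℓ₂ ag t s m = Matches-locality K χ ℓ₁ ℓ₂ ag t s m
  Matches-locality K (χ ∨ₚ χ') ℓ₁ ℓ₂ ag (t , t') s (m , m') =
    Matches-locality K χ ℓ₁ ℓ₂ (λ s a o → ag s a (inj₁ o)) t s m ,
    Matches-locality K χ' ℓ₁ ℓ₂ (λ s a o → ag s a (inj₂ o)) t' s m'
  Matches-locality K (X χ) ℓ₁ ℓ₂ ag (_ , t) s m = Matches-locality K χ ℓ₁ ℓ₂ ag t s m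
  Matches-locality K (χ U χ') ℓ₁ ℓ₂ ag (_ , t , t') s (m , m') =
    Matches-locality K χ ℓ₁ ℓ₂ (λ s a o → ag s a (inj₁ o)) t s m ,
    Matches-locality K χ' ℓ₁ ℓ₂ (λ s a o → ag s a (inj₂ o)) t' s m'

  module _ (K : Kripke AP) where

    labelOf : (χ : PathF) → Path K → Hint χ
    labelOf (st φ)    ρ = ⟦ K , ρ ⊨ₚ st φ ⟧
    labelOf (¬ₚ χ)    ρ = labelOf χ ρ
    labelOf (χ ∨ₚ χ') ρ = labelOf χ ρ , labelOf χ' ρ
    labelOf (X χ)     ρ = ⟦ K , ρ ⊨ₚ X χ ⟧ , labelOf χ ρ
    labelOf (χ U χ')  ρ = ⟦ K , ρ ⊨ₚ (χ U χ') ⟧ , labelOf χ ρ , labelOf χ' ρ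

    holds-labelOf : (χ : PathF) (ρ : Path K) → (holds χ (labelOf χ ρ) ≡ true) ⟺ (K , ρ ⊨ₚ χ)
    holds-labelOf (st φ) ρ = ⟦⟧-elim , ⟦⟧-intro
    holds-labelOf (¬ₚ χ) ρ =
      (λ e h → not-true e (proj₂ (holds-labelOf χ ρ) h)) , (λ ¬h → true-not (¬h ∘ proj₁ (holds-labelOf χ ρ)))
    holds-labelOf (χ ∨ₚ χ') ρ =
      (λ e → Sum.map (proj₁ (holds-labelOf χ ρ)) (proj₁ (holds-labelOf χ' ρ)) (∨-true e)) ,
      (λ h → true-∨ (Sum.map (proj₂ (holds-labelOf χ ρ)) (proj₂ (holds-labelOf χ' ρ)) h))
    holds-labelOf (X χ) ρ = ⟦⟧-elim , ⟦⟧-intro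
    holds-labelOf (χ U χ') ρ = ⟦⟧-elim , ⟦⟧-intro

    holds≡⟦⟧ : (χ : PathF) (ρ : Path K) → holds χ (labelOf χ ρ) ≡ ⟦ K , ρ ⊨ₚ χ ⟧
    holds≡⟦⟧ χ ρ = ⟦⟧-char _ (proj₁ (holds-labelOf χ ρ)) (proj₂ (holds-labelOf χ ρ))

    labelOf-≈ : (χ : PathF) {ρ ρ' : Path K} → ρ ≈ ρ' → labelOf χ ρ ≡ labelOf χ ρ'
    labelOf-≈ (st φ)    e = ⟦⟧-cong (sat-≈ (st φ) e) (sat-≈ (st φ) (≈-sym e))
    labelOf-≈ (¬ₚ χ)    e = labelOf-≈ χ e
    labelOf-≈ (χ ∨ₚ χ') e = cong₂ _,_ (labelOf-≈ χ e) (labelOf-≈ χ' e)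
    labelOf-≈ (X χ)     e = cong₂ _,_ (⟦⟧-cong (sat-≈ (X χ) e) (sat-≈ (X χ) (≈-sym e))) (labelOf-≈ χ e)
    labelOf-≈ (χ U χ')  e =
      cong₂ _,_ (⟦⟧-cong (sat-≈ (χ U χ') e) (sat-≈ (χ U χ') (≈-sym e)))
                (cong₂ _,_ (labelOf-≈ χ e) (labelOf-≈ χ' e))

    until-flag : (χ χ' : PathF) (ρ : Path K) →
      ⟦ K , ρ ⊨ₚ (χ U χ') ⟧ ≡ holds χ' (labelOf χ' ρ) ∨ (holds χ (labelOf χ ρ) ∧ ⟦ K , suffix 1 ρ ⊨ₚ (χ U χ') ⟧)
    until-flag χ χ' ρ = sym (⟦⟧-char _ to from)
      where
      to : holds χ' (labelOf χ' ρ) ∨ (holds χ (labelOf χ ρ) ∧ ⟦ K , suffix 1 ρ ⊨ₚ (χ U χ') ⟧) ≡ true →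
           K , ρ ⊨ₚ (χ U χ')
      to e with ∨-true e
      ... | inj₁ e' = until-fold χ χ' ρ (inj₁ (proj₁ (holds-labelOf χ' ρ) e'))
      ... | inj₂ e' = until-fold χ χ' ρ (inj₂ (proj₁ (holds-labelOf χ ρ) (proj₁ (∧-true e')) ,
                                               ⟦⟧-elim (proj₂ (∧-true e'))))
      from : K , ρ ⊨ₚ (χ U χ') →
             holds χ' (labelOf χ' ρ) ∨ (holds χ (labelOf χ ρ) ∧ ⟦ K , suffix 1 ρ ⊨ₚ (χ U χ') ⟧) ≡ true
      from h with until-unfold χ χ' ρ h
      ... | inj₁ h' = true-∨ (inj₁ (proj₂ (holds-labelOf χ' ρ) h'))
      ... | inj₂ (h₁ , h₂) = true-∨ {holds χ' (labelOf χ' ρ)}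
                               (inj₂ (true-∧ (proj₂ (holds-labelOf χ ρ) h₁) (⟦⟧-intro h₂)))

    next-labelOf : (χ : PathF) (ρ : Path K) → next χ (labelOf χ ρ) (labelOf χ (suffix 1 ρ)) ≡ true
    next-labelOf (st φ)    ρ = refl
    next-labelOf (¬ₚ χ)    ρ = next-labelOf χ ρ
    next-labelOf (χ ∨ₚ χ') ρ = true-∧ (next-labelOf χ ρ) (next-labelOf χ' ρ)
    next-labelOf (X χ)     ρ = true-∧ (true-== (sym (holds≡⟦⟧ χ (suffix 1 ρ)))) (next-labelOf χ ρ)
    next-labelOf (χ U χ')  ρ =
      true-∧ (true-== (until-flag χ χ' ρ)) (true-∧ (next-labelOf χ ρ) (next-labelOf χ' ρ))

    matches-labelOf : (χ : PathF) (ρ : Path K) → Matches K χ (labelOf χ ρ) (seq ρ 0)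
    matches-labelOf (st φ)    ρ = ⟦⟧-elim , ⟦⟧-intro
    matches-labelOf (¬ₚ χ)    ρ = matches-labelOf χ ρ
    matches-labelOf (χ ∨ₚ χ') ρ = matches-labelOf χ ρ , matches-labelOf χ' ρ
    matches-labelOf (X χ)     ρ = matches-labelOf χ ρ
    matches-labelOf (χ U χ')  ρ = matches-labelOf χ ρ , matches-labelOf χ' ρ

    Faithful : {ψ : PathF} → UntilNode ψ → Set
    Faithful {ψ} u = ∀ ρ → project (labelOf ψ ρ) ≡ labelOf (left U right) ρ
      where open UntilNode u

    untilNodes-faithful : (ψ χ : PathF) (π : Hint ψ → Hint χ) → (∀ ρ → π (labelOf ψ ρ) ≡ labelOf χ ρ) →
                          ∀ {u} → u ∈ untilNodes ψ χ π → Faithful u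
    untilNodes-faithful ψ (st φ) π hπ ()
    untilNodes-faithful ψ (¬ₚ χ) π hπ mem = untilNodes-faithful ψ χ π hπ mem
    untilNodes-faithful ψ (χ ∨ₚ χ') π hπ mem with ∈-++⁻ (untilNodes ψ χ (proj₁ ∘ π)) mem
    ... | inj₁ mem' = untilNodes-faithful ψ χ (proj₁ ∘ π) (cong proj₁ ∘ hπ) mem'
    ... | inj₂ mem' = untilNodes-faithful ψ χ' (proj₂ ∘ π) (cong proj₂ ∘ hπ) mem'
    untilNodes-faithful ψ (X χ) π hπ mem = untilNodes-faithful ψ χ (proj₂ ∘ π) (cong proj₂ ∘ hπ) mem
    untilNodes-faithful ψ (χ U χ') π hπ (here refl) = hπ
    untilNodes-faithful ψ (χ U χ') π hπ (there mem) with ∈-++⁻ (untilNodes ψ χ (proj₁ ∘ proj₂ ∘ π)) mem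
    ... | inj₁ mem' = untilNodes-faithful ψ χ (proj₁ ∘ proj₂ ∘ π) (cong (proj₁ ∘ proj₂) ∘ hπ) mem'
    ... | inj₂ mem' = untilNodes-faithful ψ χ' (proj₂ ∘ proj₂ ∘ π) (cong (proj₂ ∘ proj₂) ∘ hπ) mem'

    eventuality-faithful : (ψ : PathF) → ∀ {u} → u ∈ eventualities ψ → (∀ t → pending u t ≡ false) ⊎ Faithful u
    eventuality-faithful ψ (here refl) = inj₁ (λ _ → refl)
    eventuality-faithful ψ (there mem) = inj₂ (untilNodes-faithful ψ ψ id (λ _ → refl) mem)

-- The translation.  Fix an injection p : ℕ → AP and an offset B beyond which the p n are fresh.
module Translation (lem : ExcludedMiddle 0ℓ) (AP : Set) (inj : ℕ ↣ AP) where
  open Syntax AP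
  open Freshness lem AP inj using (p)
  open Connectives lem AP (p 0)
  open Hintikka AP
  open BoolTruth

  -- The QCTL encoding of E ψ, given for each label t a formula `matches t` stating that the
  -- state-formula entries of t are correct at the current state.  Existentially quantified
  -- markers m₀ … m_{N-1} (one per label) trace a path: the current state carries a marker whose
  -- label asserts ψ, and globally every marked state is correctly described by its label, has a
  -- marked successor with a `next` label, and fulfils every pending until of its label.
  -- Fulfilment ("a marked `next`-chain leads to a label satisfying the goal") is a reachability
  -- property, expressed as a least fixpoint: every set y₀ … y_{N-1} of markers closed under the
  -- base and step rules contains the current label.
  module Encode (B : ℕ) (ψ : PathF) where
    N : ℕ
    N = proj₁ (finite-Hint ψ)

    label : Fin N → Hint ψ
    label = Inverse.to (proj₂ (finite-Hint ψ))

    mark reach : Fin N → AP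
    mark  k = p (B + toℕ k)
    reach k = p (B + N + toℕ k)

    m y : Fin N → QCTL
    m k = atom (mark k)
    y k = atom (reach k)

    M : ℕ
    M = length (eventualities ψ)

    eventuality : Fin M → UntilNode ψ
    eventuality = lookup (eventualities ψ)

    closedBase : (Hint ψ → Bool) → QCTL
    closedBase goal = ⋀ N (λ k → (m k ∧q const (goal (label k))) ⇒q y k)

    closedStep : QCTL
    closedStep = ⋀ N (λ k → (m k ∧q EX (⋁ N (λ l → m l ∧q (const (next ψ (label k) (label l)) ∧q y l)))) ⇒q y k)

    fulfil : Fin N → (Hint ψ → Bool) → QCTL
    fulfil j goal = ¬q ∃⃗ N reach (¬q ((AG (closedBase goal) ∧q AG closedStep) ⇒q y j))

    hasNext : Fin N → QCTL
    hasNext j = EX (⋁ N (λ l → m l ∧q const (next ψ (label j) (label l))))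

    fulfilsAll : Fin N → QCTL
    fulfilsAll j = ⋀ M (λ c → const (pending (eventuality c) (label j)) ⇒q fulfil j (goal (eventuality c)))

    consistent : (Hint ψ → QCTL) → Fin N → QCTL
    consistent matches j = matches (label j) ∧q (hasNext j ∧q fulfilsAll j)

    invariant : (Hint ψ → QCTL) → QCTL
    invariant matches = ⋀ N (λ j → m j ⇒q consistent matches j)

    start : QCTL
    start = ⋁ N (λ j → m j ∧q const (holds ψ (label j)))

    body : (Hint ψ → QCTL) → QCTL
    body matches = start ∧q AG (invariant matches)

    encoding : (Hint ψ → QCTL) → QCTL
    encoding matches = ∃⃗ N mark (body matches)

  mutual
    translate : ℕ → StateF → QCTL
    translate B (atom x)  = atom x
    translate B (¬ₛ φ)    = ¬q translate B φ
    translate B (φ ∨ₛ φ') = translate B φ ∨q translate B φ'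
    translate B (∃ₚ x φ)  = ∃q x (translate B φ)
    translate B (E ψ)     = Encode.encoding B ψ (matchesF B ψ)

    matchesF : ℕ → (χ : PathF) → Hint χ → QCTL
    matchesF B (st φ)    true         = translate B φ
    matchesF B (st φ)    false        = ¬q translate B φ
    matchesF B (¬ₚ χ)    t            = matchesF B χ t
    matchesF B (χ ∨ₚ χ') (t , t')     = matchesF B χ t ∧q matchesF B χ' t'
    matchesF B (X χ)     (_ , t)      = matchesF B χ t
    matchesF B (χ U χ')  (_ , t , t') = matchesF B χ t ∧q matchesF B χ' t'

module EncodingCorrectness (lem : ExcludedMiddle 0ℓ) (AP : Set) (inj : ℕ ↣ AP) where
  open Syntax AP
  open Kripke
  open Path
  open Classical lem
  open Paths AP
  open Locality lem AP
  open Freshness lem AP inj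
  open Connectives lem AP (p 0)
  open Hintikka AP
  open PathLabels lem AP
  open Translation lem AP inj
  open BoolTruth

  module Markers (B : ℕ) (ψ : PathF) where
    open Encode B ψ public

    mark-injective : ∀ {k k'} → mark k ≡ mark k' → k ≡ k'
    mark-injective e = toℕ-injective (+-cancelˡ-≡ B _ _ (p-injective e))

    reach-injective : ∀ {k k'} → reach k ≡ reach k' → k ≡ k'
    reach-injective e = toℕ-injective (+-cancelˡ-≡ (B + N) _ _ (p-injective e))

    mark≢reach : ∀ k k' → mark k ≢ reach k'
    mark≢reach k k' e = <⇒≱ (toℕ<n k) (subst (N ≤_) (sym k≡N+k') (m≤m+n N (toℕ k')))
      where
      k≡N+k' : toℕ k ≡ N + toℕ k'
      k≡N+k' = +-cancelˡ-≡ B _ _ (trans (p-injective e) (+-assoc B N (toℕ k')))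

    agree-off-marks : FreshFrom B (λ a → OccP a ψ) → (K : Kripke AP) (ℓ' : Q K → AP → Bool) →
                      (∀ s a → Outside N mark a → ℓ' s a ≡ ℓ K s a) → AgreeOn K ℓ' (ℓ K) (λ a → OccP a ψ)
    agree-off-marks fr K ℓ' ℓ'≈ℓ s a o = ℓ'≈ℓ s a (λ k a≡mk → fresh fr (B + toℕ k) (m≤m+n B _) (subst (λ z → OccP z ψ) a≡mk o))

    indexOf : Hint ψ → Fin N
    indexOf = Inverse.from (proj₂ (finite-Hint ψ))

    label-indexOf : ∀ t → label (indexOf t) ≡ t
    label-indexOf = Inverse.strictlyInverseˡ (proj₂ (finite-Hint ψ))

  -- Soundness: if ψ holds along a path ρ, marking every position i with the label of the i-th
  -- suffix of ρ witnesses the encoding at the start of ρ.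
  module Soundness (B : ℕ) (ψ : PathF) (matches : Hint ψ → QCTL)
    (matches-complete : ∀ {K s t} → Matches K ψ t s → K , s ⊨q matches t)
    (fr : FreshFrom B (λ a → OccP a ψ))
    (S : Kripke AP) (ρ : Path S) (ρ⊨ψ : S , ρ ⊨ₚ ψ) where
    open Markers B ψ

    τ : ℕ → Hint ψ
    τ i = labelOf S ψ (suffix i ρ)

    idx : ℕ → Fin N
    idx i = indexOf (τ i)

    label-idx : ∀ i → label (idx i) ≡ τ i
    label-idx i = label-indexOf (τ i)

    next-τ : ∀ i → next ψ (τ i) (τ (suc i)) ≡ true
    next-τ i = subst (λ t → next ψ (τ i) t ≡ true)
                     (labelOf-≈ S ψ (suffix-suffix ρ 1 i)) (next-labelOf S ψ (suffix i ρ))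

    Marked : Q S → Fin N → Set
    Marked s k = Σ ℕ λ i → (seq ρ i ≡ s) × (label k ≡ τ i)

    IsMark : AP → Set
    IsMark a = Σ (Fin N) λ k → a ≡ mark k

    ℓm : Q S → AP → Bool
    ℓm = override IsMark (λ s a → ⟦ Σ (Fin N) (λ k → (a ≡ mark k) × Marked s k) ⟧) (ℓ S)

    S' : Kripke AP
    S' = relabel S ℓm

    marked→m : ∀ {s k} → Marked s k → S' , s ⊨q m k
    marked→m {k = k} h = ⟨ trans (override-in IsMark _ _ (k , refl)) (⟦⟧-intro (k , refl , h)) ⟩

    m→marked : ∀ {s k} → S' , s ⊨q m k → Marked s k
    m→marked {s} {k} ⟨ e ⟩ with ⟦⟧-elim (trans (sym (override-in IsMark _ _ (k , refl))) e)
    ... | k' , mk≡mk' , h = subst (Marked s) (sym (mark-injective mk≡mk')) h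

    ℓm-off-marks : ∀ s a → Outside N mark a → ℓm s a ≡ ℓ S s a
    ℓm-off-marks s a out = override-out IsMark _ _ (λ (k , a≡mk) → out k a≡mk)

    marked-at : ∀ i → S' , seq ρ i ⊨q m (idx i)
    marked-at i = marked→m (i , refl , label-idx i)

    -- Backward induction along ρ: if the y-markers are closed under the base and step rules
    -- for `goal` from position i on, and the goal holds at position w + i, then every position
    -- t + i ≤ w + i carries the y-marker of its label.
    closed-contains : ∀ i (goal : Hint ψ → Bool) (ℓy : Q S → AP → Bool) →
      (∀ s a → Outside N reach a → ℓy s a ≡ ℓm s a) →
      relabel S ℓy , seq ρ i ⊨q (AG (closedBase goal) ∧q AG closedStep) →
      ∀ w → goal (τ (w + i)) ≡ true → ∀ d t → d + t ≡ w → ∀ k → label k ≡ τ (t + i) →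
      relabel S ℓy , seq ρ (t + i) ⊨q y k
    closed-contains i goal ℓy ℓy≈ℓm closed w goal-w = backwards
      where
      S'' : Kripke AP
      S'' = relabel S ℓy
      ρ'' : Path S''
      ρ'' = relabelPath S (ℓ S) ℓy (suffix i ρ)
      baseRule : ∀ t → S'' , seq ρ (t + i) ⊨q closedBase goal
      baseRule t = AG-sat (proj₁ (∧-sat closed)) ρ'' refl t
      stepRule : ∀ t → S'' , seq ρ (t + i) ⊨q closedStep
      stepRule t = AG-sat (proj₂ (∧-sat closed)) ρ'' refl t
      marked'' : ∀ {s k} → Marked s k → S'' , s ⊨q m k
      marked'' {s} {k} h = ⟨ trans (ℓy≈ℓm s (mark k) (mark≢reach k)) (un (marked→m h)) ⟩
      backwards : ∀ d t → d + t ≡ w → ∀ k → label k ≡ τ (t + i) → S'' , seq ρ (t + i) ⊨q y k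
      backwards zero t refl k lk =
        ⇒-sat (⋀-sat N _ (baseRule t) k)
              (sat-∧ (marked'' (t + i , refl , lk)) (sat-const (subst (λ z → goal z ≡ true) (sym lk) goal-w)))
      backwards (suc d) t d+t≡w k lk =
        ⇒-sat (⋀-sat N _ (stepRule t) k)
              (sat-∧ (marked'' (t + i , refl , lk))
                     (sat-EX (seq ρ (suc t + i)) (step ρ (t + i))
                             (sat-⋁ N _ l (sat-∧ (marked'' (suc t + i , refl , label-idx _))
                                                 (sat-∧ (sat-const next-ok) later)))))
        where
        l : Fin N
        l = idx (suc t + i)
        next-ok : next ψ (label k) (label l) ≡ true
        next-ok = subst₂ (λ a b → next ψ a b ≡ true) (sym lk) (sym (label-idx _)) (next-τ (t + i))
        later : S'' , seq ρ (suc t + i) ⊨q y l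
        later = backwards d (suc t) (trans (+-suc d t) d+t≡w) l (label-idx (suc t + i))

    -- If label j describes position i and its faithful until-node u is pending, the until holds
    -- on the i-th suffix, so its goal is reached at some w + i and `fulfil` holds at i.
    fulfilled : ∀ i j → label j ≡ τ i → (u : UntilNode ψ) → Faithful S u → pending u (label j) ≡ true →
                S' , seq ρ i ⊨q fulfil j (goal u)
    fulfilled i j lj≡τi u faithful pend = sat-¬ refute
      where
      open UntilNode u
      U-holds : S , suffix i ρ ⊨ₚ (left U right)
      U-holds = ⟦⟧-elim (trans (sym (cong proj₁ (faithful (suffix i ρ)))) (subst (λ t → pending u t ≡ true) lj≡τi pend))
      w : ℕ
      w = proj₁ U-holds
      goal-at-w : goal u (τ (w + i)) ≡ true
      goal-at-w = trans (cong (holds right ∘ proj₂ ∘ proj₂) (faithful (suffix (w + i) ρ)))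
                        (proj₂ (holds-labelOf S right _) (sat-≈ right (suffix-suffix ρ w i) (proj₁ (proj₂ U-holds))))
      refute : ¬ (S' , seq ρ i ⊨q ∃⃗ N reach (¬q ((AG (closedBase (goal u)) ∧q AG closedStep) ⇒q y j)))
      refute h with ∃⃗-sat N reach _ h
      ... | ℓy , ℓy≈ℓm , ¬closed⇒yj = ¬-sat ¬closed⇒yj (sat-⇒ λ closed →
        closed-contains i (goal u) ℓy ℓy≈ℓm closed w goal-at-w w 0 (+-identityʳ w) j lj≡τi)

    consistent-at : ∀ {s} j → Marked s j → S' , s ⊨q consistent matches j
    consistent-at j (i , refl , lj≡τi) = sat-∧ matches-here (sat-∧ has-next fulfils)
      where
      matches-here : S' , seq ρ i ⊨q matches (label j)
      matches-here = matches-complete (subst (λ t → Matches S' ψ t (seq ρ i)) (sym lj≡τi)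
        (Matches-locality S ψ (ℓ S) ℓm (λ s a o → sym (agree-off-marks fr S ℓm ℓm-off-marks s a o))
                          (τ i) (seq ρ i) (matches-labelOf S ψ (suffix i ρ))))
      has-next : S' , seq ρ i ⊨q hasNext j
      has-next = sat-EX (seq ρ (suc i)) (step ρ i)
        (sat-⋁ N _ (idx (suc i)) (sat-∧ (marked-at (suc i))
          (sat-const (subst₂ (λ a b → next ψ a b ≡ true) (sym lj≡τi) (sym (label-idx (suc i))) (next-τ i)))))
      fulfils : S' , seq ρ i ⊨q fulfilsAll j
      fulfils = sat-⋀ M _ λ c → sat-⇒ λ pend → case eventuality-faithful S ψ (∈-lookup c) of λ where
        (inj₁ idle)     → ⊥-elim (true≢false (trans (sym (const-sat _ pend)) (idle (label j))))
        (inj₂ faithful) → fulfilled i j lj≡τi (eventuality c) faithful (const-sat _ pend)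

    sound : S , seq ρ 0 ⊨q encoding matches
    sound = sat-∃⃗ N mark (body matches) ℓm ℓm-off-marks (sat-∧ started (sat-AG invariant-holds))
      where
      holds-at-0 : holds ψ (label (idx 0)) ≡ true
      holds-at-0 = subst (λ t → holds ψ t ≡ true) (sym (label-idx 0))
                         (proj₂ (holds-labelOf S ψ (suffix 0 ρ)) (sat-≈ ψ (≈-sym (suffix-zero ρ)) ρ⊨ψ))
      started : S' , seq ρ 0 ⊨q start
      started = sat-⋁ N _ (idx 0) (sat-∧ (marked-at 0) (sat-const holds-at-0))
      invariant-holds : Globally S' (seq ρ 0) (λ s → S' , s ⊨q invariant matches)
      invariant-holds _ _ _ = sat-⋀ N _ λ j → sat-⇒ λ mj → consistent-at j (m→marked mj)

  -- Completeness: markers witnessing the encoding at s₀ yield a path from s₀ through marked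
  -- states with `next`-related labels, on which every pending until is eventually fulfilled
  -- (a round-robin schedule serves the eventualities in turn).  Along this path every label
  -- tells the truth, so ψ holds on it.
  module Completeness (B : ℕ) (ψ : PathF) (matches : Hint ψ → QCTL)
    (matches-sound : ∀ {K s t} → K , s ⊨q matches t → Matches K ψ t s)
    (fr : FreshFrom B (λ a → OccP a ψ))
    (S : Kripke AP) (s₀ : Q S) (s₀⊨enc : S , s₀ ⊨q Markers.encoding B ψ matches) where
    open Markers B ψ
    open ≡-Reasoning

    marking : Σ (Q S → AP → Bool) λ ℓ' → (∀ s a → Outside N mark a → ℓ' s a ≡ ℓ S s a) × relabel S ℓ' , s₀ ⊨q body matches
    marking = ∃⃗-sat N mark (body matches) s₀⊨enc

    ℓ' : Q S → AP → Bool
    ℓ' = proj₁ marking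

    S' : Kripke AP
    S' = relabel S ℓ'

    Invariant : Q S → Set
    Invariant s = S' , s ⊨q invariant matches

    Good : Q S → Fin N → Set
    Good s j = S' , s ⊨q m j × Globally S' s Invariant

    start-good : Σ (Fin N) λ j → Good s₀ j × holds ψ (label j) ≡ true
    start-good with ⋁-sat N _ (proj₁ (∧-sat (proj₂ (proj₂ marking))))
    ... | j , mj∧holds = j , (proj₁ (∧-sat mj∧holds) , AG-sat (proj₂ (∧-sat (proj₂ (proj₂ marking)))))
                           , const-sat _ (proj₂ (∧-sat mj∧holds))

    consistent-good : ∀ {s j} → Good s j → S' , s ⊨q consistent matches j
    consistent-good (mj , inv) = ⇒-sat (⋀-sat N _ (Globally-here {P = Invariant} inv) _) mj

    matches-good : ∀ {s j} → Good s j → Matches S' ψ (label j) s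
    matches-good g = matches-sound (proj₁ (∧-sat (consistent-good g)))

    Successor : Q S → Fin N → Set
    Successor s j = Σ (Q S) λ s' → Σ (Fin N) λ l → R S s s' × S' , s' ⊨q m l × next ψ (label j) (label l) ≡ true

    successor : ∀ {s j} → Good s j → Successor s j
    successor g with EX-sat (proj₁ (∧-sat (proj₂ (∧-sat (consistent-good g)))))
    ... | s' , r , h with ⋁-sat N _ h
    ... | l , ml∧next = s' , l , r , proj₁ (∧-sat ml∧next) , const-sat _ (proj₂ (∧-sat ml∧next))

    good-step : ∀ {s j s' l} → Good s j → R S s s' → S' , s' ⊨q m l → Good s' l
    good-step (_ , inv) r ml = ml , Globally-step {P = Invariant} inv r

    data Reaches (goal : Hint ψ → Bool) : Q S → Fin N → Set where
      arrived : ∀ {s k} → goal (label k) ≡ true → Reaches goal s k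
      via     : ∀ {s k s' l} → R S s s' → S' , s' ⊨q m l → next ψ (label k) (label l) ≡ true →
                Reaches goal s' l → Reaches goal s k

    -- The fixpoint formula `fulfil` really expresses reachability: take y to be Reaches itself.
    fulfil→Reaches : ∀ s j goal → S' , s ⊨q fulfil j goal → Reaches goal s j
    fulfil→Reaches s j goal hf = y→Reaches (⇒-sat closed⇒yj (sat-∧ (sat-AG base-closed) (sat-AG step-closed)))
      where
      IsReach : AP → Set
      IsReach a = Σ (Fin N) λ k → a ≡ reach k
      ℓy : Q S → AP → Bool
      ℓy = override IsReach (λ s a → ⟦ Σ (Fin N) (λ k → (a ≡ reach k) × Reaches goal s k) ⟧) ℓ'
      S'' : Kripke AP
      S'' = relabel S ℓy
      ℓy-off-reach : ∀ s a → Outside N reach a → ℓy s a ≡ ℓ' s a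
      ℓy-off-reach s a out = override-out IsReach _ _ (λ (k , a≡rk) → out k a≡rk)
      y→Reaches : ∀ {s k} → S'' , s ⊨q y k → Reaches goal s k
      y→Reaches {s} {k} ⟨ e ⟩ with ⟦⟧-elim (trans (sym (override-in IsReach _ _ (k , refl))) e)
      ... | k' , rk≡rk' , r = subst (Reaches goal s) (sym (reach-injective rk≡rk')) r
      Reaches→y : ∀ {s k} → Reaches goal s k → S'' , s ⊨q y k
      Reaches→y {k = k} r = ⟨ trans (override-in IsReach _ _ (k , refl)) (⟦⟧-intro (k , refl , r)) ⟩
      m''→m : ∀ {s k} → S'' , s ⊨q m k → S' , s ⊨q m k
      m''→m {s} {k} ⟨ e ⟩ = ⟨ trans (sym (ℓy-off-reach s (mark k) (mark≢reach k))) e ⟩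
      closed⇒yj : S'' , s ⊨q ((AG (closedBase goal) ∧q AG closedStep) ⇒q y j)
      closed⇒yj = ¬¬-elim λ ¬impl → ¬-sat hf (sat-∃⃗ N reach _ ℓy ℓy-off-reach (sat-¬ ¬impl))
      base-closed : Globally S'' s (λ s' → S'' , s' ⊨q closedBase goal)
      base-closed _ _ _ = sat-⋀ N _ λ k → sat-⇒ λ mk∧goal → Reaches→y (arrived (const-sat _ (proj₂ (∧-sat mk∧goal))))
      stepRule : ∀ {s₁} k → S'' , s₁ ⊨q (m k ∧q EX (⋁ N (λ l → m l ∧q (const (next ψ (label k) (label l)) ∧q y l)))) →
                 S'' , s₁ ⊨q y k
      stepRule k h with EX-sat (proj₂ (∧-sat h))
      ... | s₂ , r , h₂ with ⋁-sat N _ h₂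
      ... | l , hl = Reaches→y (via r (m''→m (proj₁ (∧-sat hl)))
                                     (const-sat _ (proj₁ (∧-sat (proj₂ (∧-sat hl)))))
                                     (y→Reaches (proj₂ (∧-sat (proj₂ (∧-sat hl))))))
      step-closed : Globally S'' s (λ s' → S'' , s' ⊨q closedStep)
      step-closed _ _ _ = sat-⋀ N _ λ k → sat-⇒ (stepRule k)

    pending→Reaches : ∀ {s j} → Good s j → ∀ c → pending (eventuality c) (label j) ≡ true →
                      Reaches (goal (eventuality c)) s j
    pending→Reaches {s} {j} g c pend =
      fulfil→Reaches s j _ (⇒-sat (⋀-sat M (λ c → const (pending (eventuality c) (label j)) ⇒q fulfil j (goal (eventuality c)))
                                          (proj₂ (∧-sat (proj₂ (∧-sat (consistent-good g))))) c) (sat-const pend))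

    slot : ℕ → Fin M
    slot c = F.fromℕ< (m%n<n c M)

    slot-periodic : ∀ (t : Fin M) c → slot (toℕ t + c * M) ≡ t
    slot-periodic t c = toℕ-injective (begin
      toℕ (slot (toℕ t + c * M)) ≡⟨ toℕ-fromℕ< (m%n<n (toℕ t + c * M) M) ⟩
      (toℕ t + c * M) % M        ≡⟨ [m+kn]%n≡m%n (toℕ t) c M ⟩
      toℕ t % M                  ≡⟨ m<n⇒m%n≡m (toℕ<n t) ⟩
      toℕ t                      ∎)

    obligation : ℕ → UntilNode ψ
    obligation c = eventuality (slot c)

    Plan : Q S → Fin N → ℕ → Set
    Plan s j c = Reaches (goal (obligation c)) s j ⊎ (pending (obligation c) (label j) ≡ false)

    plan : ∀ {s j} → Good s j → ∀ c → Plan s j c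
    plan {s} {j} g c with pending (obligation c) (label j) in pend
    ... | true  = inj₁ (pending→Reaches g (slot c) pend)
    ... | false = inj₂ refl

    record Config : Set where
      constructor config
      field
        state   : Q S
        lab     : Fin N
        good    : Good state lab
        counter : ℕ
        current : Plan state lab counter
    open Config

    moveOnVia : ∀ {s j} → Good s j → Successor s j → ℕ → Config
    moveOnVia g (s' , l , r , ml , _) c = config s' l (good-step g r ml) (suc c) (plan (good-step g r ml) (suc c))

    moveOn : ∀ {s j} → Good s j → ℕ → Config
    moveOn g = moveOnVia g (successor g)

    advance : Config → Config
    advance (config s j g c (inj₁ (via r ml _ rest))) = config _ _ (good-step g r ml) c (inj₁ rest)
    advance (config s j g c (inj₁ (arrived _)))       = moveOn g c
    advance (config s j g c (inj₂ _))                 = moveOn g c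

    moveOn-step : ∀ {s j} (g : Good s j) c →
                  R S s (state (moveOn g c)) × next ψ (label j) (label (lab (moveOn g c))) ≡ true
    moveOn-step {s} {j} g c = via-step (successor g)
      where
      via-step : (sc : Successor s j) →
                 R S s (state (moveOnVia g sc c)) × next ψ (label j) (label (lab (moveOnVia g sc c))) ≡ true
      via-step (_ , _ , r , _ , nx) = r , nx

    advance-step : ∀ x → R S (state x) (state (advance x)) × next ψ (label (lab x)) (label (lab (advance x))) ≡ true
    advance-step (config s j g c (inj₁ (via r _ nx _))) = r , nx
    advance-step (config s j g c (inj₁ (arrived _)))    = moveOn-step g c
    advance-step (config s j g c (inj₂ _))              = moveOn-step g c

    iterate : ℕ → Config → Config
    iterate zero    x = x
    iterate (suc n) x = iterate n (advance x)

    iterate-+ : ∀ a b x → iterate (a + b) x ≡ iterate b (iterate a x)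
    iterate-+ zero    b x = refl
    iterate-+ (suc a) b x = iterate-+ a b (advance x)

    iterate-step : ∀ n x → R S (state (iterate n x)) (state (iterate n (advance x))) ×
                           next ψ (label (lab (iterate n x))) (label (lab (iterate n (advance x)))) ≡ true
    iterate-step zero    x = advance-step x
    iterate-step (suc n) x = iterate-step n (advance x)

    follow : ∀ {s j} (g : Good s j) c (r : Reaches (goal (obligation c)) s j) →
             Σ ℕ λ K → goal (obligation c) (label (lab (iterate K (config s j g c (inj₁ r))))) ≡ true ×
                       counter (iterate (suc K) (config s j g c (inj₁ r))) ≡ suc c
    follow g c (arrived e)       = 0 , e , refl
    follow g c (via r ml _ rest) with follow (good-step g r ml) c rest
    ... | K , e , e' = suc K , e , e'

    next-obligation : ∀ x → Σ ℕ λ K → counter (iterate K x) ≡ suc (counter x)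
    next-obligation (config s j g c (inj₁ r)) = suc (proj₁ (follow g c r)) , proj₂ (proj₂ (follow g c r))
    next-obligation (config s j g c (inj₂ _)) = 1 , refl

    counter-reaches : ∀ k x → Σ ℕ λ K → counter (iterate K x) ≡ k + counter x
    counter-reaches zero    x = 0 , refl
    counter-reaches (suc k) x with next-obligation x
    ... | K₁ , e₁ with counter-reaches k (iterate K₁ x)
    ... | K₂ , e₂ = K₁ + K₂ , (begin
      counter (iterate (K₁ + K₂) x)  ≡⟨ cong counter (iterate-+ K₁ K₂ x) ⟩
      counter (iterate K₂ (iterate K₁ x)) ≡⟨ e₂ ⟩
      k + counter (iterate K₁ x)     ≡⟨ cong (k +_) e₁ ⟩
      k + suc (counter x)            ≡⟨ +-suc k (counter x) ⟩
      suc k + counter x              ∎)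

    discharged : ∀ x → pending (obligation (counter x)) (label (lab x)) ≡ true →
                 Σ ℕ λ K → goal (obligation (counter x)) (label (lab (iterate K x))) ≡ true
    discharged (config s j g c (inj₁ r))  _    = proj₁ (follow g c r) , proj₁ (proj₂ (follow g c r))
    discharged (config s j g c (inj₂ np)) pend = ⊥-elim (true≢false (trans (sym pend) np))

    initial : Config
    initial = config s₀ j₀ g₀ 0 (plan g₀ 0)
      where
      j₀ : Fin N
      j₀ = proj₁ start-good
      g₀ : Good s₀ j₀
      g₀ = proj₁ (proj₂ start-good)

    ρ* : Path S'
    ρ* = record { seq = λ n → state (iterate n initial) ; step = λ n → proj₁ (iterate-step n initial) }

    τ* : ℕ → Hint ψ
    τ* n = label (lab (iterate n initial))

    next-τ* : ∀ n → next ψ (τ* n) (τ* (suc n)) ≡ true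
    next-τ* n = proj₂ (iterate-step n initial)

    matches-τ* : ∀ n → Matches S' ψ (τ* n) (seq ρ* n)
    matches-τ* n = matches-good (good (iterate n initial))

    fair : ∀ (t : Fin M) n → Σ ℕ λ P → (n ≤ P) ×
           (pending (eventuality t) (τ* P) ≡ true → Σ ℕ λ P' → (P ≤ P') × (goal (eventuality t) (τ* P') ≡ true))
    fair t n = n + K , m≤m+n n K , reached
      where
      x : Config
      x = iterate n initial
      target : ℕ
      target = toℕ t + counter x * M
      counter≤target : counter x ≤ target
      counter≤target = ≤-trans (m≤m*n (counter x) M) (m≤n+m _ (toℕ t))
      K : ℕ
      K = proj₁ (counter-reaches (target ∸ counter x) x)
      x′ : Config
      x′ = iterate K x
      at-target : counter x′ ≡ target
      at-target = trans (proj₂ (counter-reaches (target ∸ counter x) x)) (m∸n+n≡m counter≤target)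
      x′-obligation : obligation (counter x′) ≡ eventuality t
      x′-obligation = cong eventuality (trans (cong slot at-target) (slot-periodic t (counter x)))
      x′-position : iterate (n + K) initial ≡ x′
      x′-position = iterate-+ n K initial
      conclude : Σ ℕ (λ K' → goal (obligation (counter x′)) (label (lab (iterate K' x′))) ≡ true) →
                Σ ℕ λ P' → (n + K ≤ P') × (goal (eventuality t) (τ* P') ≡ true)
      conclude (K' , goal-reached) = n + K + K' , m≤m+n (n + K) K' ,
        subst₂ (λ u z → goal u (label (lab z)) ≡ true) x′-obligation
               (sym (trans (iterate-+ (n + K) K' initial) (cong (iterate K') x′-position))) goal-reached
      reached : pending (eventuality t) (τ* (n + K)) ≡ true →
                Σ ℕ λ P' → (n + K ≤ P') × (goal (eventuality t) (τ* P') ≡ true)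
      reached pend = conclude (discharged x′ (subst₂ (λ u z → pending u (label (lab z)) ≡ true)
                                                         (sym x′-obligation) x′-position pend))

    fair-node : ∀ {u} → u ∈ eventualities ψ → ∀ n → Σ ℕ λ P → (n ≤ P) ×
                (pending u (τ* P) ≡ true → Σ ℕ λ P' → (P ≤ P') × (goal u (τ* P') ≡ true))
    fair-node mem = subst (λ u → ∀ n → Σ ℕ λ P → (n ≤ P) ×
                             (pending u (τ* P) ≡ true → Σ ℕ λ P' → (P ≤ P') × (goal u (τ* P') ≡ true)))
                          (sym (lookup-index mem)) (fair (index mem))

    -- A subformula χ of ψ, reached through the projection π of labels: `next`, Matches and the
    -- until nodes of ψ restrict to it.
    record Projection (χ : PathF) : Set where
      field
        π         : Hint ψ → Hint χ
        π-next    : ∀ {t t'} → next ψ t t' ≡ true → next χ (π t) (π t') ≡ true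
        π-matches : ∀ {s t} → Matches S' ψ t s → Matches S' χ (π t) s
        π-nodes   : ∀ {u} → u ∈ untilNodes ψ χ π → u ∈ eventualities ψ
    open Projection

    ψ-proj : Projection ψ
    ψ-proj = record { π = id ; π-next = id ; π-matches = id ; π-nodes = there }

    ¬-proj : ∀ {χ} → Projection (¬ₚ χ) → Projection χ
    ¬-proj P = record { π = π P ; π-next = π-next P ; π-matches = π-matches P ; π-nodes = π-nodes P }

    ∨ˡ-proj : ∀ {χ χ'} → Projection (χ ∨ₚ χ') → Projection χ
    ∨ˡ-proj P = record
      { π = proj₁ ∘ π P ; π-next = proj₁ ∘ ∧-true ∘ π-next P ; π-matches = proj₁ ∘ π-matches P
      ; π-nodes = π-nodes P ∘ ∈-++⁺ˡ }

    ∨ʳ-proj : ∀ {χ χ'} → Projection (χ ∨ₚ χ') → Projection χ'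
    ∨ʳ-proj {χ} P = record
      { π = proj₂ ∘ π P ; π-next = λ {t} {t'} e → proj₂ (∧-true {next χ (proj₁ (π P t)) (proj₁ (π P t'))} (π-next P e)) ; π-matches = proj₂ ∘ π-matches P
      ; π-nodes = π-nodes P ∘ ∈-++⁺ʳ (untilNodes ψ χ (proj₁ ∘ π P)) }

    X-proj : ∀ {χ} → Projection (X χ) → Projection χ
    X-proj {χ} P = record
      { π = proj₂ ∘ π P ; π-next = λ {t} {t'} e → proj₂ (∧-true {proj₁ (π P t) == holds χ (proj₂ (π P t'))} (π-next P e)) ; π-matches = π-matches P
      ; π-nodes = π-nodes P }

    U-next : ∀ {χ χ'} (P : Projection (χ U χ')) {t t'} → next ψ t t' ≡ true →
             next χ (proj₁ (proj₂ (π P t))) (proj₁ (proj₂ (π P t'))) ≡ true ×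
             next χ' (proj₂ (proj₂ (π P t))) (proj₂ (proj₂ (π P t'))) ≡ true
    U-next {χ} {χ'} P {t} {t'} e = ∧-true (proj₂ (∧-true {flag-rule} (π-next P e)))
      where
      flag-rule : Bool
      flag-rule = proj₁ (π P t) == (holds χ' (proj₂ (proj₂ (π P t))) ∨ (holds χ (proj₁ (proj₂ (π P t))) ∧ proj₁ (π P t')))

    Uˡ-proj : ∀ {χ χ'} → Projection (χ U χ') → Projection χ
    Uˡ-proj P = record
      { π = proj₁ ∘ proj₂ ∘ π P ; π-next = proj₁ ∘ U-next P ; π-matches = proj₁ ∘ π-matches P
      ; π-nodes = π-nodes P ∘ there ∘ ∈-++⁺ˡ }

    Uʳ-proj : ∀ {χ χ'} → Projection (χ U χ') → Projection χ'
    Uʳ-proj {χ} P = record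
      { π = proj₂ ∘ proj₂ ∘ π P ; π-next = proj₂ ∘ U-next P ; π-matches = proj₂ ∘ π-matches P
      ; π-nodes = π-nodes P ∘ there ∘ ∈-++⁺ʳ (untilNodes ψ χ (proj₁ ∘ proj₂ ∘ π P)) }

    truth : (χ : PathF) (P : Projection χ) → ∀ n → (S' , suffix n ρ* ⊨ₚ χ) ⟺ (holds χ (π P (τ* n)) ≡ true)
    truth (st φ) P n = Product.swap (π-matches P (matches-τ* n))
    truth (¬ₚ χ) P n = (λ ¬h → true-not (¬h ∘ proj₂ IH)) , (λ e h → not-true e (proj₁ IH h))
      where
      IH : (S' , suffix n ρ* ⊨ₚ χ) ⟺ (holds χ (π (¬-proj P) (τ* n)) ≡ true)
      IH = truth χ (¬-proj P) n
    truth (χ ∨ₚ χ') P n =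
      (λ h → true-∨ (Sum.map (proj₁ IH) (proj₁ IH') h)) , (λ e → Sum.map (proj₂ IH) (proj₂ IH') (∨-true e))
      where
      IH : (S' , suffix n ρ* ⊨ₚ χ) ⟺ (holds χ (π (∨ˡ-proj P) (τ* n)) ≡ true)
      IH = truth χ (∨ˡ-proj P) n
      IH' : (S' , suffix n ρ* ⊨ₚ χ') ⟺ (holds χ' (π (∨ʳ-proj P) (τ* n)) ≡ true)
      IH' = truth χ' (∨ʳ-proj P) n
    truth (X χ) P n =
      (λ h → trans flag (proj₁ IH (sat-≈ χ (suffix-suffix ρ* 1 n) h))) ,
      (λ e → sat-≈ χ (≈-sym (suffix-suffix ρ* 1 n)) (proj₂ IH (trans (sym flag) e)))
      where
      IH : (S' , suffix (suc n) ρ* ⊨ₚ χ) ⟺ (holds χ (π (X-proj P) (τ* (suc n))) ≡ true)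
      IH = truth χ (X-proj P) (suc n)
      flag : proj₁ (π P (τ* n)) ≡ holds χ (proj₂ (π P (τ* (suc n))))
      flag = ==-true (proj₁ (∧-true (π-next P (next-τ* n))))
    truth (χ U χ') P n = to , from
      where
      IH : ∀ k → (S' , suffix k ρ* ⊨ₚ χ) ⟺ (holds χ (π (Uˡ-proj P) (τ* k)) ≡ true)
      IH = truth χ (Uˡ-proj P)
      IH' : ∀ k → (S' , suffix k ρ* ⊨ₚ χ') ⟺ (holds χ' (π (Uʳ-proj P) (τ* k)) ≡ true)
      IH' = truth χ' (Uʳ-proj P)
      flag a b : ℕ → Bool
      flag k = proj₁ (π P (τ* k))
      a    k = holds χ (π (Uˡ-proj P) (τ* k))
      b    k = holds χ' (π (Uʳ-proj P) (τ* k))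
      unfold : ∀ k → flag k ≡ b k ∨ (a k ∧ flag (suc k))
      unfold k = ==-true (proj₁ (∧-true (π-next P (next-τ* k))))
      open UntilSeq flag a b unfold
      to : S' , suffix n ρ* ⊨ₚ (χ U χ') → flag n ≡ true
      to (i , h' , h) = until⇒flag i n (proj₁ (IH' (i + n)) (sat-≈ χ' (suffix-suffix ρ* i n) h'))
                                     (λ j j<i → proj₁ (IH (j + n)) (sat-≈ χ (suffix-suffix ρ* j n) (h j j<i)))
      from : flag n ≡ true → S' , suffix n ρ* ⊨ₚ (χ U χ')
      from e = back (flag⇒until (fair-node (π-nodes P (here refl))) n e)
        where
        back : Until n → S' , suffix n ρ* ⊨ₚ (χ U χ')
        back (i , bi , as) = i , sat-≈ χ' (≈-sym (suffix-suffix ρ* i n)) (proj₂ (IH' (i + n)) bi) ,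
                             λ j j<i → sat-≈ χ (≈-sym (suffix-suffix ρ* j n)) (proj₂ (IH (j + n)) (as j j<i))

    complete : S , s₀ ⊨ₛ E ψ
    complete = relabelPath S ℓ' (ℓ S) ρ* , refl ,
               localityₚ S ℓ' (ℓ S) ψ (agree-off-marks fr S ℓ' (proj₁ (proj₂ marking))) ρ* ρ*⊨ψ
      where
      ρ*⊨ψ : S' , ρ* ⊨ₚ ψ
      ρ*⊨ψ = sat-≈ ψ (suffix-zero ρ*) (proj₂ (truth ψ ψ-proj 0) (proj₂ (proj₂ start-good)))

module TranslationCorrectness (lem : ExcludedMiddle 0ℓ) (AP : Set) (inj : ℕ ↣ AP) where
  open Syntax AP
  open Kripke
  open Locality lem AP
  open Freshness lem AP inj
  open Connectives lem AP (p 0)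
  open Hintikka AP
  open PathLabels lem AP
  open Translation lem AP inj
  open EncodingCorrectness lem AP inj
  open BoolTruth

  both : ∀ {K s θ θ'} {P P' : Set} → (K , s ⊨q θ) ⟺ P → (K , s ⊨q θ') ⟺ P' → (K , s ⊨q (θ ∧q θ')) ⟺ (P × P')
  both (to , from) (to' , from') = (λ h → to (proj₁ (∧-sat h)) , to' (proj₂ (∧-sat h))) ,
                                   (λ (x , x') → sat-∧ (from x) (from' x'))

  mutual
    translate-correct : ∀ B φ → FreshFrom B (λ a → OccS a φ) → ∀ K s → (K , s ⊨ₛ φ) ⟺ (K , s ⊨q translate B φ)
    translate-correct B (atom x) fr K s = ⟨_⟩ , un
    translate-correct B (¬ₛ φ) fr K s =
      (λ ¬h → sat-¬ (¬h ∘ proj₂ (translate-correct B φ fr K s))) ,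
      (λ h h' → ¬-sat h (proj₁ (translate-correct B φ fr K s) h'))
    translate-correct B (φ ∨ₛ φ') fr K s =
      (λ { (inj₁ h) → ⟨ inj₁ (un (proj₁ IH h)) ⟩ ; (inj₂ h) → ⟨ inj₂ (un (proj₁ IH' h)) ⟩ }) ,
      (λ { ⟨ inj₁ h ⟩ → inj₁ (proj₂ IH ⟨ h ⟩) ; ⟨ inj₂ h ⟩ → inj₂ (proj₂ IH' ⟨ h ⟩) })
      where
      IH : (K , s ⊨ₛ φ) ⟺ (K , s ⊨q translate B φ)
      IH = translate-correct B φ (fresh-mono inj₁ fr) K s
      IH' : (K , s ⊨ₛ φ') ⟺ (K , s ⊨q translate B φ')
      IH' = translate-correct B φ' (fresh-mono inj₂ fr) K s
    translate-correct B (∃ₚ x φ) fr K s =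
      (λ (ℓ' , ℓ'≈ℓ , h) → ⟨ ℓ' , ℓ'≈ℓ , un (proj₁ (IH ℓ') h) ⟩) ,
      (λ { ⟨ ℓ' , ℓ'≈ℓ , h ⟩ → ℓ' , ℓ'≈ℓ , proj₂ (IH ℓ') ⟨ h ⟩ })
      where
      IH : ∀ ℓ' → (relabel K ℓ' , s ⊨ₛ φ) ⟺ (relabel K ℓ' , s ⊨q translate B φ)
      IH ℓ' = translate-correct B φ (fresh-mono inj₂ fr) (relabel K ℓ') s
    translate-correct B (E ψ) fr K s =
      (λ { (ρ , refl , h) → Soundness.sound B ψ (matchesF B ψ) matches-complete fr K ρ h }) ,
      Completeness.complete B ψ (matchesF B ψ) matches-sound fr K s
      where
      matches-complete : ∀ {K s t} → Matches K ψ t s → K , s ⊨q matchesF B ψ t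
      matches-complete {K} {s} {t} = proj₂ (matchesF-correct B ψ fr K s t)
      matches-sound : ∀ {K s t} → K , s ⊨q matchesF B ψ t → Matches K ψ t s
      matches-sound {K} {s} {t} = proj₁ (matchesF-correct B ψ fr K s t)

    matchesF-correct : ∀ B χ → FreshFrom B (λ a → OccP a χ) → ∀ K s t →
                       (K , s ⊨q matchesF B χ t) ⟺ Matches K χ t s
    matchesF-correct B (st φ) fr K s true =
      (λ h → (λ _ → proj₂ IH h) , (λ _ → refl)) , (λ (to , _) → proj₁ IH (to refl))
      where
      IH : (K , s ⊨ₛ φ) ⟺ (K , s ⊨q translate B φ)
      IH = translate-correct B φ fr K s
    matchesF-correct B (st φ) fr K s false =
      (λ h → (λ ()) , (λ h' → ⊥-elim (¬-sat h (proj₁ IH h')))) ,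
      (λ (_ , from) → sat-¬ (λ h → true≢false (sym (from (proj₂ IH h)))))
      where
      IH : (K , s ⊨ₛ φ) ⟺ (K , s ⊨q translate B φ)
      IH = translate-correct B φ fr K s
    matchesF-correct B (¬ₚ χ) fr K s t = matchesF-correct B χ fr K s t
    matchesF-correct B (χ ∨ₚ χ') fr K s (t , t') = both (matchesF-correct B χ (fresh-mono inj₁ fr) K s t)
                                                       (matchesF-correct B χ' (fresh-mono inj₂ fr) K s t')
    matchesF-correct B (X χ) fr K s (_ , t) = matchesF-correct B χ fr K s t
    matchesF-correct B (χ U χ') fr K s (_ , t , t') = both (matchesF-correct B χ (fresh-mono inj₁ fr) K s t)
                                                          (matchesF-correct B χ' (fresh-mono inj₂ fr) K s t')

proposition3p8 : ExcludedMiddle 0ℓ → (AP : Set) → ℕ ↣ AP →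
    (Φ : Syntax.StateF AP) →
    Σ (Syntax.QCTL AP) λ Ψ →
    (_≡s_ {AP} Φ (Syntax.embed AP Ψ)) × (_≡t_ {AP} Φ (Syntax.embed AP Ψ))
proposition3p8 lem AP inj Φ =
  translate B Φ , (λ n S q → correct (toKripke S) q) , (λ n S q → correct (unwind S q) (root S q))
  where
  open Syntax AP
  open Freshness lem AP inj
  open Connectives lem AP (p 0)
  open Translation lem AP inj
  open TranslationCorrectness lem AP inj
  B : ℕ
  B = proj₁ (freshS Φ)
  correct : (K : Kripke AP) (s : Kripke.Q K) → (K , s ⊨ₛ Φ) ⟺ (K , s ⊨ₛ embed (translate B Φ))
  correct K s = (un ∘ proj₁ equivalent) , (proj₂ equivalent ∘ ⟨_⟩)
    where
    equivalent : (K , s ⊨ₛ Φ) ⟺ (K , s ⊨q translate B Φ)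
    equivalent = translate-correct B Φ (proj₂ (freshS Φ)) K s
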